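{- Let $d\ge 1$ be an integer and let $\mathbf e_1,\dots,\mathbf e_{2d+1}$ be the standard basis of $\mathbb R^{2d+1}$. For $i,j\in[d]=\{1,\dots,d\}$ let $\mathbf a_{ij}=\mathbf e_j+\mathbf e_{d+i}+\delta_{ij}\mathbf e_{2d+1}$. Let $K=\{\sum_{i,j}x_{ij}\mathbf a_{ij}: x_{ij}\in\mathbb R_{\ge0}\}$, $Q=\{\sum_{i,j}x_{ij}\mathbf a_{ij}: x_{ij}\in\mathbb Z_{\ge0}\}$ and $Q_{\mathrm{sat}}=K\cap\mathbb Z^{2d+1}$. For $k,l\in[d]$ put $\mathbf h_{kl}=\tfrac12(\mathbf a_{ll}+\mathbf a_{lk}+\mathbf a_{kl}+\mathbf a_{kk})$ and $\mathcal F=\{\mathbf h_{kl}: k,l\in[d],\ k<l\}$. Then the minimal Hilbert basis of the semigroup $Q_{\mathrm{sat}}$ is $\{\mathbf a_{ij}\}_{i,j\in[d]}\cup\mathcal F$.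
   Context: The minimal Hilbert basis of a pointed affine semigroup is its unique inclusion-minimal generating set (the set of its irreducible nonzero elements). $Q_{\mathrm{sat}}$ is the saturation of the semigroup $Q$ generated by the columns of the common diagonal effect model matrix.
   Formalization: The cone K is taken with coefficients $x_{ij}$ in the nonnegative rationals instead of $\mathbb R_{\ge0}$. -}

module Defs where

open import Data.Nat as ℕ using (ℕ; zero; suc)
open import Data.Fin as Fin using (Fin; _↑ˡ_; _↑ʳ_)
open import Data.Fin.Properties using (_≟_)
open import Data.Integer as ℤ using (ℤ; +_)
open import Data.Rational as ℚ using (ℚ; 0ℚ; ½; NonNegative)
open import Data.Product using (Σ; ∃; ∃-syntax; _×_)
open import Data.Sum using (_⊎_)
open import Relation.Binary.PropositionalEquality using (_≡_)
open import Relation.Nullary using (¬_; yes; no)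

-- ambient dimension 2d+1; coordinates indexed by Fin (d + d + 1):
-- coordinate j (1..d) is  j ↑ˡ d ↑ˡ 1,  coordinate d+i is  d ↑ʳ i ↑ˡ 1,
-- coordinate 2d+1 is  (d + d) ↑ʳ 0.
Coord : ℕ → Set
Coord d = Fin (d ℕ.+ d ℕ.+ 1)

δ : ∀ {n} → Fin n → Fin n → ℤ
δ c c' with c ≟ c'
... | yes _ = + 1
... | no  _ = + 0

colC : ∀ {d} → Fin d → Coord d
colC {d} j = (j ↑ˡ d) ↑ˡ 1

rowC : ∀ {d} → Fin d → Coord d
rowC {d} i = (d ↑ʳ i) ↑ˡ 1

lastC : ∀ {d} → Coord d
lastC {d} = (d ℕ.+ d) ↑ʳ Fin.zero

a : (d : ℕ) → Fin d → Fin d → Coord d → ℤ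
a d i j c = (δ (colC j) c ℤ.+ δ (rowC i) c) ℤ.+ δ i j ℤ.* δ (lastC {d}) c

toℚ : ℤ → ℚ
toℚ z = z ℚ./ 1

∑ : ∀ {n} → (Fin n → ℚ) → ℚ
∑ {zero}  f = 0ℚ
∑ {suc n} f = f Fin.zero ℚ.+ ∑ (λ k → f (Fin.suc k))

h : (d : ℕ) → Fin d → Fin d → Coord d → ℚ
h d k l c = ½ ℚ.* toℚ (((a d l l c ℤ.+ a d l k c) ℤ.+ a d k l c) ℤ.+ a d k k c)

Qsat : (d : ℕ) → (Coord d → ℤ) → Set
Qsat d v = Σ (Fin d → Fin d → ℚ) λ x → ((∀ (i j : Fin d) → NonNegative (x i j)) ×
  (∀ (c : Coord d) → toℚ (v c) ≡ ∑ (λ i → ∑ (λ j → x i j ℚ.* toℚ (a d i j c)))))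

addV : (d : ℕ) → (Coord d → ℤ) → (Coord d → ℤ) → Coord d → ℤ
addV d u w c = u c ℤ.+ w c

IsZero : (d : ℕ) → (Coord d → ℤ) → Set
IsZero d v = ∀ c → v c ≡ + 0

-- membership in the minimal Hilbert basis of Q_sat (= irreducible nonzero elements)
InMinHilbertBasis : (d : ℕ) → (Coord d → ℤ) → Set
InMinHilbertBasis d v = Qsat d v × ¬ IsZero d v ×
  (∀ u w → Qsat d u → Qsat d w → (∀ c → v c ≡ addV d u w c) → IsZero d u ⊎ IsZero d w)

InClaimedSet : (d : ℕ) → (Coord d → ℤ) → Set
InClaimedSet d v =
  (∃[ i ] ∃[ j ] (∀ c → v c ≡ a d i j c)) ⊎
  (∃[ k ] ∃[ l ] (k Fin.< l × (∀ c → toℚ (v c) ≡ h d k l c)))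

{-# OPTIONS --safe #-}

-- Read a vector of ℤ^(2d+1) as margins: the column sums c, row sums r and trace t of a d × d matrix.
-- The integer points of K are the margins with c, r, t ≥ 0, Σ r = Σ c = n, r m + c m ≤ n + t and
-- t ≤ Σ min (r m) (c m): every nonnegative rational matrix satisfies these inequalities, and conversely
-- every nonzero solution remains one after subtracting the margins of a suitable a_ij or h_kl (the tight
-- inequalities dictate which), so by induction on n it is a sum of generator margins.  This peeling also
-- shows that every irreducible element of Q_sat is a generator.  Conversely, a_ij has mass n = 1, and h_kl
-- could only split into two parts of mass 1 with traces 0 and 1; but a traceless part of mass 1 occupies
-- the lines k and l once each and leaves the other part no room on the diagonal.

module Submission where

open import Defs
open import Data.Nat as ℕ using (ℕ; zero; suc; _+_; _*_; _∸_; _⊓_; _≤_; _<_; z≤n; s≤s)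
open import Data.Nat.Properties as ℕ
  using (≤-refl; ≤-trans; ≤-reflexive; +-comm; +-assoc; +-identityʳ; m≤m+n; m≤n+m; +-mono-≤; +-monoʳ-≤; +-monoˡ-≤;
         n≤0⇒n≡0; +-cancelˡ-≤; +-cancelʳ-≤; +-cancelˡ-≡; m+[n∸m]≡n; m⊓n≤m; m⊓n≤n; ⊓-comm; ⊓-glb;
         m≥n⇒m⊓n≡n; m≤n⇒m⊓n≡m; +-distribˡ-⊓; ≮⇒≥; ≰⇒>; <⇒≢; n≢0⇒n>0; ≤-total; ≤-antisym;
         ≤-pred; +-suc; ⊓-idem; m⊓n≤m+n)
open import Data.Nat.Tactic.RingSolver using (solve-∀)
open import Data.Integer as ℤ using (ℤ; +≤+)
import Data.Integer.Properties as ℤ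
open import Data.Rational as ℚ using (ℚ; 0ℚ; 1ℚ; ½; NonNegative; mkℚ)
import Data.Rational.Properties as ℚ
open import Data.Nat.Coprimality as Coprime using (1-coprimeTo)
open import Data.Fin as Fin using (Fin; punchIn; punchOut; _↑ˡ_; _↑ʳ_; splitAt)
open import Data.Fin.Properties
  using (_≟_; any?; punchIn-punchOut; punchOut-injective; punchInᵢ≢i; splitAt-↑ˡ; splitAt-↑ʳ; splitAt⁻¹-↑ˡ;
         splitAt⁻¹-↑ʳ; ↑ˡ-injective; ↑ʳ-injective; suc-injective; <-cmp)
  renaming (<⇒≢ to <ᶠ⇒≢)
open import Data.Product using (Σ; ∃-syntax; _×_; _,_; proj₁; proj₂)
open import Data.Sum as Sum using (_⊎_; inj₁; inj₂; [_,_]′)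
open import Data.Empty using (⊥)
open import Function using (_∘_)
open import Relation.Nullary using (¬_; yes; no; contradiction)
open import Relation.Nullary.Decidable using (¬?; _×-dec_)
open import Relation.Unary using (Pred; Decidable)
open import Relation.Binary using (tri<; tri≈; tri>)
open import Relation.Binary.PropositionalEquality
  using (_≡_; _≢_; _≗_; refl; sym; trans; cong; cong₂; subst; subst₂; module ≡-Reasoning)
open import Algebra.Bundles using (CommutativeRing)

open import Algebra.Properties.Semiring.Sum ℕ.+-*-semiring
  using (sum; sum-cong-≗; ∑-distrib-+; sum-replicate-zero; sum-remove)
open import Algebra.Properties.Semiring.Sum (CommutativeRing.semiring ℚ.+-*-commutativeRing)
  using ()
  renaming (sum to ∑ℚ; sum-cong-≗ to ∑ℚ-cong; ∑-distrib-+ to ∑ℚ-distrib-+; ∑-comm to ∑ℚ-comm;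
            *-distribˡ-sum to *-distribˡ-∑ℚ; *-distribʳ-sum to *-distribʳ-∑ℚ; sum-replicate-zero to ∑ℚ-zero;
            sum-remove to ∑ℚ-remove)

private variable n d : ℕ

δℕ : Fin n → Fin n → ℕ
δℕ Fin.zero    Fin.zero    = 1
δℕ Fin.zero    (Fin.suc _) = 0
δℕ (Fin.suc _) Fin.zero    = 0
δℕ (Fin.suc x) (Fin.suc y) = δℕ x y

δℕ-refl : (x : Fin n) → δℕ x x ≡ 1
δℕ-refl Fin.zero    = refl
δℕ-refl (Fin.suc x) = δℕ-refl x

δℕ-≢ : {x y : Fin n} → x ≢ y → δℕ x y ≡ 0
δℕ-≢ {x = Fin.zero}  {Fin.zero}  x≢y = contradiction refl x≢y
δℕ-≢ {x = Fin.zero}  {Fin.suc _} _   = refl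
δℕ-≢ {x = Fin.suc _} {Fin.zero}  _   = refl
δℕ-≢ {x = Fin.suc x} {Fin.suc y} x≢y = δℕ-≢ (x≢y ∘ cong Fin.suc)

δℕ-sym : (x y : Fin n) → δℕ x y ≡ δℕ y x
δℕ-sym Fin.zero    Fin.zero    = refl
δℕ-sym Fin.zero    (Fin.suc _) = refl
δℕ-sym (Fin.suc _) Fin.zero    = refl
δℕ-sym (Fin.suc x) (Fin.suc y) = δℕ-sym x y

δℕ-line : (i j m : Fin n) → δℕ i m + δℕ j m ≤ 1 + δℕ i j
δℕ-line i j m with i ≟ m | j ≟ m
... | yes refl | yes refl rewrite δℕ-refl i = ≤-refl
... | yes refl | no  j≢i  rewrite δℕ-refl i | δℕ-≢ j≢i | δℕ-sym i j | δℕ-≢ j≢i = ≤-refl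
... | no  i≢j  | yes refl rewrite δℕ-refl j | δℕ-≢ i≢j = ≤-refl
... | no  i≢m  | no  j≢m  rewrite δℕ-≢ i≢m | δℕ-≢ j≢m = z≤n

δℕ-injective : ∀ {m} (f : Fin m → Fin n) → (∀ {x y} → f x ≡ f y → x ≡ y) → ∀ x y → δℕ (f x) (f y) ≡ δℕ x y
δℕ-injective f f-injective x y with x ≟ y
... | yes refl = trans (δℕ-refl (f x)) (sym (δℕ-refl x))
... | no  x≢y  = trans (δℕ-≢ (x≢y ∘ f-injective)) (sym (δℕ-≢ x≢y))

sum-δℕ : (z : Fin n) → sum (δℕ z) ≡ 1
sum-δℕ {suc n} Fin.zero = cong suc (sum-replicate-zero n)
sum-δℕ (Fin.suc z)      = sum-δℕ z

sum-δℕ-* : (f : Fin n → ℕ) (k : Fin n) → sum (λ m → δℕ k m * f m) ≡ f k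
sum-δℕ-* {suc n} f Fin.zero    =
  trans (cong₂ _+_ (+-identityʳ (f Fin.zero)) (sum-replicate-zero n)) (+-identityʳ (f Fin.zero))
sum-δℕ-* {suc n} f (Fin.suc k) = sum-δℕ-* (f ∘ Fin.suc) k

sum-mono-≤ : {f g : Fin n → ℕ} → (∀ m → f m ≤ g m) → sum f ≤ sum g
sum-mono-≤ {zero}  f≤g = z≤n
sum-mono-≤ {suc n} f≤g = +-mono-≤ (f≤g Fin.zero) (sum-mono-≤ (f≤g ∘ Fin.suc))

≤-sum : (f : Fin n → ℕ) (z : Fin n) → f z ≤ sum f
≤-sum f Fin.zero    = m≤m+n _ _
≤-sum f (Fin.suc z) = ≤-trans (≤-sum (f ∘ Fin.suc) z) (m≤n+m _ _)

sum-≡0 : (f : Fin n → ℕ) → sum f ≡ 0 → ∀ m → f m ≡ 0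
sum-≡0 f Σf≡0 m = n≤0⇒n≡0 (≤-trans (≤-sum f m) (≤-reflexive Σf≡0))

≤-sum₂ : (f : Fin n → ℕ) {z w : Fin n} → z ≢ w → f z + f w ≤ sum f
≤-sum₂ {suc n} f {z} {w} z≢w = begin
  f z + f w                     ≡⟨ cong (λ k → f z + f k) (punchIn-punchOut z≢w) ⟨
  f z + f (punchIn z w′)        ≤⟨ +-monoʳ-≤ (f z) (≤-sum (f ∘ punchIn z) w′) ⟩
  f z + sum (f ∘ punchIn z)     ≡⟨ sum-remove f ⟨
  sum f                         ∎
  where
  open ℕ.≤-Reasoning
  w′ = punchOut z≢w

≤-sum₃ : (f : Fin n → ℕ) {z w m : Fin n} → z ≢ w → z ≢ m → w ≢ m → f z + f w + f m ≤ sum f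
≤-sum₃ {suc n} f {z} {w} {m} z≢w z≢m w≢m = begin
  f z + f w + f m                                     ≡⟨ +-assoc (f z) (f w) (f m) ⟩
  f z + (f w + f m)                                   ≡⟨ cong₂ (λ a b → f z + (f a + f b))
                                                           (punchIn-punchOut z≢w) (punchIn-punchOut z≢m) ⟨
  f z + (f (punchIn z w′) + f (punchIn z m′))         ≤⟨ +-monoʳ-≤ (f z)
                                                           (≤-sum₂ (f ∘ punchIn z) (w≢m ∘ punchOut-injective z≢w z≢m)) ⟩
  f z + sum (f ∘ punchIn z)                           ≡⟨ sum-remove f ⟨
  sum f                                               ∎
  where
  open ℕ.≤-Reasoning
  w′ = punchOut z≢w
  m′ = punchOut z≢m

sum-positive : (f : Fin n → ℕ) → 0 < sum f → ∃[ m ] 0 < f m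
sum-positive {n} f 0<Σf with any? (λ m → 0 ℕ.<? f m)
... | yes found = found
... | no  none  = contradiction (≤-trans (sum-mono-≤ f≤0) (≤-reflexive (sum-replicate-zero n))) (ℕ.<⇒≱ 0<Σf)
  where
  f≤0 : ∀ m → f m ≤ 0
  f≤0 m = ≮⇒≥ (λ 0<fm → none (m , 0<fm))

sum-positive-elsewhere : (f : Fin n → ℕ) (z : Fin n) → f z < sum f → ∃[ m ] m ≢ z × 0 < f m
sum-positive-elsewhere {suc n} f z fz<Σf =
  let k , 0<fk = sum-positive (f ∘ punchIn z) 0<rest
  in punchIn z k , punchInᵢ≢i z k , 0<fk
  where
  open ℕ.≤-Reasoning
  0<rest : 0 < sum (f ∘ punchIn z)
  0<rest = ℕ.+-cancelˡ-< (f z) 0 _ (begin-strict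
    f z + 0                    ≡⟨ +-identityʳ (f z) ⟩
    f z                        <⟨ fz<Σf ⟩
    sum f                      ≡⟨ sum-remove f ⟩
    f z + sum (f ∘ punchIn z)  ∎)

+-≤-≡ˡ : {a b c d : ℕ} → a ≤ c → b ≤ d → a + b ≡ c + d → a ≡ c
+-≤-≡ˡ a≤c b≤d a+b≡c+d = ≤-antisym a≤c (≮⇒≥ (λ a<c → ℕ.<-irrefl a+b≡c+d (ℕ.+-mono-<-≤ a<c b≤d)))

sum-≤-≗ : {f g : Fin n → ℕ} → (∀ m → f m ≤ g m) → sum f ≡ sum g → f ≗ g
sum-≤-≗ {suc n} {f} {g} f≤g Σf≡Σg = λ
  { Fin.zero    → head≡
  ; (Fin.suc m) → sum-≤-≗ (f≤g ∘ Fin.suc) (+-cancelˡ-≡ (f Fin.zero) _ _ (trans Σf≡Σg (cong (_+ _) (sym head≡)))) m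
  }
  where
  head≡ : f Fin.zero ≡ g Fin.zero
  head≡ = +-≤-≡ˡ (f≤g Fin.zero) (sum-mono-≤ (f≤g ∘ Fin.suc)) Σf≡Σg

sum-surplus : {f g : Fin n → ℕ} {i : Fin n} → sum f ≡ sum g → g i < f i → ∃[ j ] f j < g j
sum-surplus {f = f} {g} {i = i} Σf≡Σg gᵢ<fᵢ with any? (λ j → f j ℕ.<? g j)
... | yes found = found
... | no  ∄     = contradiction (sum-≤-≗ (λ j → ≮⇒≥ (λ fⱼ<gⱼ → ∄ (j , fⱼ<gⱼ))) (sym Σf≡Σg) i) (<⇒≢ gᵢ<fᵢ)

sum-split : {f g h : Fin n → ℕ} → f ≗ (λ m → g m + h m) → sum f ≡ sum g + sum h
sum-split {g = g} {h} f≗g+h = trans (sum-cong-≗ f≗g+h) (∑-distrib-+ g h)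

data Occurrences {p} (P : Pred (Fin n) p) : Set p where
  none : (∀ m → ¬ P m) → Occurrences P
  one  : ∀ z → P z → (∀ m → m ≢ z → ¬ P m) → Occurrences P
  two  : ∀ {z w} → z ≢ w → P z → P w → Occurrences P

occurrences : ∀ {p} {P : Pred (Fin n) p} → Decidable P → Occurrences P
occurrences P? with any? P?
... | no ¬∃ = none (λ m pm → ¬∃ (m , pm))
... | yes (z , pz) with any? (λ m → ¬? (m ≟ z) ×-dec P? m)
...   | no ¬∃ = one z pz (λ m m≢z pm → ¬∃ (m , m≢z , pm))
...   | yes (w , w≢z , pw) = two (w≢z ∘ sym) pz pw

cross-≤ : ∀ {a b c n} → a + b ≤ n → n ≤ b + c → a ≤ c
cross-≤ {a} {b} {c} a+b≤n n≤b+c = +-cancelʳ-≤ b a c (≤-trans a+b≤n (≤-trans n≤b+c (≤-reflexive (+-comm b c))))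

m+n≤m⇒n≡0 : ∀ {m n} → m + n ≤ m → n ≡ 0
m+n≤m⇒n≡0 {m} m+n≤m = n≤0⇒n≡0 (+-cancelˡ-≤ m _ 0 (≤-trans m+n≤m (≤-reflexive (sym (+-identityʳ m)))))

≯0⇒≡0 : ∀ {n} → ¬ 0 < n → n ≡ 0
≯0⇒≡0 ¬0<n = n≤0⇒n≡0 (≮⇒≥ ¬0<n)

both-one : ∀ {a b} → a + b ≡ 2 → 0 < a → 0 < b → a ≡ 1 × b ≡ 1
both-one {suc zero}    {b}     a+b≡2 _ _ = refl , ℕ.suc-injective a+b≡2
both-one {suc (suc a)} {suc b} a+b≡2 _ _ = contradiction (ℕ.suc-injective (ℕ.suc-injective a+b≡2)) (ℕ.m+1+n≢0 a)

one-summand-zero : ∀ {a b} → a + b ≡ 1 → a ≡ 0 ⊎ b ≡ 0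
one-summand-zero {zero}  _     = inj₁ refl
one-summand-zero {suc a} a+b≡1 = inj₂ (ℕ.m+n≡0⇒n≡0 a (ℕ.suc-injective a+b≡1))

disjoint+⊓≤ : ∀ {a b x y e} → a + x ≡ e → b + y ≡ e → a + b ≤ 1 → a + b + x ⊓ y ≤ e
disjoint+⊓≤ {zero}  {b}    {x} {y} refl refl _ = +-monoʳ-≤ b (m⊓n≤n x y)
disjoint+⊓≤ {suc a} {zero} {x} {y} refl refl _ =
  subst (λ s → s + x ⊓ y ≤ suc a + x) (sym (+-identityʳ (suc a))) (+-monoʳ-≤ (suc a) (m⊓n≤m x y))
disjoint+⊓≤ {suc a} {suc b} _ _ (s≤s a+1+b≤0) = contradiction (≤-trans (m≤n+m (suc b) a) a+1+b≤0) λ ()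

-- Margins and the inequalities cutting out K

-- col m, row m and tr are the coefficients of e_m, e_(d+m) and e_(2d+1); for Σ x_ij a_ij they are
-- the column sums, row sums and trace of the matrix x.
record Margins (d : ℕ) : Set where
  constructor margins
  field
    col row : Fin d → ℕ
    tr      : ℕ

open Margins

private variable
  μ ν γ : Margins d
  i j k l : Fin d

mass : Margins d → ℕ
mass μ = sum (col μ)

maxTrace : Margins d → ℕ
maxTrace μ = sum (λ m → row μ m ⊓ col μ m)

TraceBound : Margins d → Set
TraceBound μ = tr μ ≤ maxTrace μ

record Feasible (μ : Margins d) : Set where
  field
    balanced    : sum (row μ) ≡ mass μ
    line-bound  : ∀ m → row μ m + col μ m ≤ mass μ + tr μ
    trace-bound : TraceBound μ

open Feasible

infixl 6 _⊕_ _⊖_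
infix 4 _≋_ _≤ₘ_

_⊕_ : Margins d → Margins d → Margins d
μ ⊕ ν = margins (λ m → col μ m + col ν m) (λ m → row μ m + row ν m) (tr μ + tr ν)

_⊖_ : Margins d → Margins d → Margins d
μ ⊖ ν = margins (λ m → col μ m ∸ col ν m) (λ m → row μ m ∸ row ν m) (tr μ ∸ tr ν)

record _≋_ (μ ν : Margins d) : Set where
  field
    col≗ : col μ ≗ col ν
    row≗ : row μ ≗ row ν
    tr≡  : tr μ ≡ tr ν

open _≋_

record _≤ₘ_ (μ ν : Margins d) : Set where
  field
    col≤ : ∀ m → col μ m ≤ col ν m
    row≤ : ∀ m → row μ m ≤ row ν m
    tr≤  : tr μ ≤ tr ν

≋-sym : {μ ν : Margins d} → μ ≋ ν → ν ≋ μ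
≋-sym μ≋ν = record { col≗ = sym ∘ col≗ μ≋ν ; row≗ = sym ∘ row≗ μ≋ν ; tr≡ = sym (tr≡ μ≋ν) }

≋-trans : {μ ν ρ : Margins d} → μ ≋ ν → ν ≋ ρ → μ ≋ ρ
≋-trans μ≋ν ν≋ρ = record
  { col≗ = λ m → trans (col≗ μ≋ν m) (col≗ ν≋ρ m)
  ; row≗ = λ m → trans (row≗ μ≋ν m) (row≗ ν≋ρ m)
  ; tr≡  = trans (tr≡ μ≋ν) (tr≡ ν≋ρ) }

⊕-comm : (μ ν : Margins d) → μ ⊕ ν ≋ ν ⊕ μ
⊕-comm μ ν = record
  { col≗ = λ m → +-comm (col μ m) (col ν m)
  ; row≗ = λ m → +-comm (row μ m) (row ν m)
  ; tr≡  = +-comm (tr μ) (tr ν) }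

⊖-split : γ ≤ₘ μ → μ ≋ γ ⊕ (μ ⊖ γ)
⊖-split γ≤μ = record
  { col≗ = λ m → sym (m+[n∸m]≡n (_≤ₘ_.col≤ γ≤μ m))
  ; row≗ = λ m → sym (m+[n∸m]≡n (_≤ₘ_.row≤ γ≤μ m))
  ; tr≡  = sym (m+[n∸m]≡n (_≤ₘ_.tr≤ γ≤μ)) }

mass-split : μ ≋ γ ⊕ ν → mass μ ≡ mass γ + mass ν
mass-split split = sum-split (col≗ split)

zeroₘ : Margins d
zeroₘ = margins (λ _ → 0) (λ _ → 0) 0

-- The margins of a_ij and of h_kl.
unit : Fin d → Fin d → Margins d
unit i j = margins (δℕ j) (δℕ i) (δℕ i j)

pair : Fin d → Fin d → Margins d
pair k l = margins (λ m → δℕ k m + δℕ l m) (λ m → δℕ k m + δℕ l m) 1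

pair-comm : {k l : Fin d} → pair k l ≋ pair l k
pair-comm {k = k} {l} = record
  { col≗ = λ m → +-comm (δℕ k m) (δℕ l m)
  ; row≗ = λ m → +-comm (δℕ k m) (δℕ l m)
  ; tr≡  = refl }

sum-pair : (k l : Fin n) → sum (λ m → δℕ k m + δℕ l m) ≡ 2
sum-pair k l = trans (∑-distrib-+ (δℕ k) (δℕ l)) (cong₂ _+_ (sum-δℕ k) (sum-δℕ l))

pair-double : {k l : Fin d} → k ≢ l → unit l l ⊕ unit l k ⊕ unit k l ⊕ unit k k ≋ pair k l ⊕ pair k l
pair-double {k = k} {l} k≢l = record
  { col≗ = λ m → col-eq (δℕ k m) (δℕ l m)
  ; row≗ = λ m → row-eq (δℕ k m) (δℕ l m)
  ; tr≡  = trace-eq }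
  where
  col-eq : ∀ a b → b + a + b + a ≡ (a + b) + (a + b)
  col-eq = solve-∀
  row-eq : ∀ a b → b + b + a + a ≡ (a + b) + (a + b)
  row-eq = solve-∀
  trace-eq : δℕ l l + δℕ l k + δℕ k l + δℕ k k ≡ 2
  trace-eq rewrite δℕ-refl l | δℕ-refl k | δℕ-≢ k≢l | δℕ-≢ (k≢l ∘ sym) = refl

data IsGenerator {d} : Margins d → Set where
  unit-gen : ∀ i j → IsGenerator (unit i j)
  pair-gen : k ≢ l → IsGenerator (pair k l)

generator-mass : {γ : Margins d} → IsGenerator γ → 0 < mass γ
generator-mass (unit-gen i j)       = ≤-reflexive (sym (sum-δℕ j))
generator-mass (pair-gen {k} {l} _) = ≤-trans (s≤s z≤n) (≤-reflexive (sym (sum-pair k l)))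

line-sum : Feasible μ → sum (λ m → row μ m + col μ m) ≡ mass μ + mass μ
line-sum {μ = μ} μ-feasible = trans (∑-distrib-+ (row μ) (col μ)) (cong (_+ mass μ) (balanced μ-feasible))

two-lines-≤ : Feasible μ → k ≢ l → (row μ k + col μ k) + (row μ l + col μ l) ≤ mass μ + mass μ
two-lines-≤ {μ = μ} μ-feasible k≢l =
  ≤-trans (≤-sum₂ (λ m → row μ m + col μ m) k≢l) (≤-reflexive (line-sum μ-feasible))

row₂≤mass : Feasible μ → k ≢ l → row μ k + row μ l ≤ mass μ
row₂≤mass {μ = μ} μ-feasible k≢l = ≤-trans (≤-sum₂ (row μ) k≢l) (≤-reflexive (balanced μ-feasible))

others-vanish : Feasible μ → k ≢ l → mass μ ≤ row μ k + col μ k → mass μ ≤ row μ l + col μ l →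
  ∀ m → m ≢ k → m ≢ l → row μ m + col μ m ≡ 0
others-vanish {μ = μ} {k = k} {l = l} μ-feasible k≢l n≤k n≤l m m≢k m≢l = m+n≤m⇒n≡0 (begin
  mass μ + mass μ + (row μ m + col μ m)
    ≤⟨ +-monoˡ-≤ _ (+-mono-≤ n≤k n≤l) ⟩
  (row μ k + col μ k) + (row μ l + col μ l) + (row μ m + col μ m)
    ≤⟨ ≤-sum₃ (λ m → row μ m + col μ m) k≢l (m≢k ∘ sym) (m≢l ∘ sym) ⟩
  sum (λ m → row μ m + col μ m)
    ≡⟨ line-sum μ-feasible ⟩
  mass μ + mass μ
    ∎)
  where open ℕ.≤-Reasoning

mass≡0⇒≋zeroₘ : {μ : Margins d} → Feasible μ → mass μ ≡ 0 → μ ≋ zeroₘ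
mass≡0⇒≋zeroₘ {μ = μ} μ-feasible n≡0 = record
  { col≗ = sum-≡0 (col μ) n≡0
  ; row≗ = sum-≡0 (row μ) (trans (balanced μ-feasible) n≡0)
  ; tr≡  = n≤0⇒n≡0 (≤-trans (trace-bound μ-feasible)
             (≤-trans (sum-mono-≤ (λ m → m⊓n≤n (row μ m) (col μ m))) (≤-reflexive n≡0))) }

positive-on-full-line : (f g : Fin n → ℕ) (z : Fin n) →
  sum g ≤ f z + g z → 0 < sum (λ m → f m ⊓ g m) → 0 < f z
positive-on-full-line {n} f g z Σg≤f+g 0<Σ⊓ with 0 ℕ.<? f z
... | yes 0<f = 0<f
... | no  ¬0<f = contradiction (trans (sum-cong-≗ vanish) (sum-replicate-zero n)) (ℕ.>⇒≢ 0<Σ⊓)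
  where
  f≡0 = ≯0⇒≡0 ¬0<f
  vanish : ∀ m → f m ⊓ g m ≡ 0
  vanish m with m ≟ z
  ... | yes refl = n≤0⇒n≡0 (≤-trans (m⊓n≤m (f m) (g m)) (≤-reflexive f≡0))
  ... | no  m≢z  = n≤0⇒n≡0 (≤-trans (m⊓n≤n (f m) (g m)) (≤-reflexive (m+n≤m⇒n≡0 (begin
    g z + g m       ≤⟨ ≤-sum₂ g (m≢z ∘ sym) ⟩
    sum g           ≤⟨ Σg≤f+g ⟩
    f z + g z       ≡⟨ cong (_+ g z) f≡0 ⟩
    g z             ∎))))
    where open ℕ.≤-Reasoning

maxTrace-diagonal : μ ≋ unit k k ⊕ ν → maxTrace μ ≡ 1 + maxTrace ν
maxTrace-diagonal {μ = μ} {k = k} {ν = ν} split = trans (sum-split pointwise) (cong (_+ maxTrace ν) (sum-δℕ k))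
  where
  pointwise : ∀ m → row μ m ⊓ col μ m ≡ δℕ k m + row ν m ⊓ col ν m
  pointwise m = trans (cong₂ _⊓_ (row≗ split m) (col≗ split m)) (sym (+-distribˡ-⊓ (δℕ k m) (row ν m) (col ν m)))

-- Subtracting a generator from feasible margins

record Peeling (μ : Margins d) : Set where
  constructor peeling
  field
    {peeled remainder} : Margins d
    generator : IsGenerator peeled
    feasible  : Feasible remainder
    split     : μ ≋ peeled ⊕ remainder

private
  cancel-summand : ∀ {rμ cμ Mμ tμ} rγ cγ Mγ tγ {rν cν Mν tν} →
    rμ ≡ rγ + rν → cμ ≡ cγ + cν → Mμ ≡ Mγ + Mν → tμ ≡ tγ + tν →
    rμ + cμ + (Mγ + tγ) ≤ Mμ + tμ + (rγ + cγ) → rν + cν ≤ Mν + tν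
  cancel-summand rγ cγ Mγ tγ {rν} {cν} {Mν} {tν} refl refl refl refl le =
    +-cancelˡ-≤ (rγ + cγ + (Mγ + tγ)) _ _
      (subst₂ _≤_ (lhs rγ cγ Mγ tγ rν cν) (rhs rγ cγ Mγ tγ Mν tν) le)
    where
    lhs : ∀ rγ cγ Mγ tγ rν cν → rγ + rν + (cγ + cν) + (Mγ + tγ) ≡ rγ + cγ + (Mγ + tγ) + (rν + cν)
    lhs = solve-∀
    rhs : ∀ rγ cγ Mγ tγ Mν tν → Mγ + Mν + (tγ + tν) + (rγ + cγ) ≡ rγ + cγ + (Mγ + tγ) + (Mν + tν)
    rhs = solve-∀

-- The facet inequalities of ν = μ − γ, rewritten in terms of μ and γ.
feasible-summand : Feasible μ → μ ≋ γ ⊕ ν → sum (row γ) ≡ mass γ →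
  (∀ m → row μ m + col μ m + (mass γ + tr γ) ≤ mass μ + tr μ + (row γ m + col γ m)) →
  TraceBound ν → Feasible ν
feasible-summand {μ = μ} {γ = γ} {ν = ν} μ-feasible split γ-balanced line-condition ν-trace = record
  { balanced    = +-cancelˡ-≡ (mass γ) _ _ (begin
      mass γ + sum (row ν)       ≡⟨ cong (_+ sum (row ν)) γ-balanced ⟨
      sum (row γ) + sum (row ν)  ≡⟨ sum-split (row≗ split) ⟨
      sum (row μ)                ≡⟨ balanced μ-feasible ⟩
      mass μ                     ≡⟨ mass-split {γ = γ} split ⟩
      mass γ + mass ν            ∎)
  ; line-bound  = λ m → cancel-summand (row γ m) (col γ m) (mass γ) (tr γ)
      (row≗ split m) (col≗ split m) (mass-split {γ = γ} split) (tr≡ split) (line-condition m)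
  ; trace-bound = ν-trace }
  where open ≡-Reasoning

δℕ-≤ : (f : Fin n → ℕ) → 0 < f j → ∀ m → δℕ j m ≤ f m
δℕ-≤ {j = j} f 0<fⱼ m with j ≟ m
... | yes refl = subst (_≤ f j) (sym (δℕ-refl j)) 0<fⱼ
... | no  j≢m  = subst (_≤ f m) (sym (δℕ-≢ j≢m)) z≤n

δℕ₂-≤ : (f : Fin n → ℕ) → k ≢ l → 0 < f k → 0 < f l → ∀ m → δℕ k m + δℕ l m ≤ f m
δℕ₂-≤ {k = k} {l = l} f k≢l 0<fₖ 0<fₗ m with k ≟ m | l ≟ m
... | yes refl | yes refl = contradiction refl k≢l
... | yes refl | no  l≢k  rewrite δℕ-refl k | δℕ-≢ l≢k = 0<fₖ
... | no  k≢l′ | yes refl rewrite δℕ-refl l | δℕ-≢ k≢l′ = 0<fₗ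
... | no  k≢m  | no  l≢m  rewrite δℕ-≢ k≢m | δℕ-≢ l≢m = z≤n

peel-unit : Feasible μ → 0 < row μ i → 0 < col μ j → δℕ i j ≤ tr μ →
  (∀ m → m ≢ i → m ≢ j → row μ m + col μ m + (1 + δℕ i j) ≤ mass μ + tr μ) →
  (∀ {ν} → μ ≋ unit i j ⊕ ν → TraceBound ν) → Peeling μ
peel-unit {μ = μ} {i = i} {j = j} μ-feasible 0<rᵢ 0<cⱼ δᵢⱼ≤t others trace =
  peeling (unit-gen i j)
    (feasible-summand μ-feasible split (trans (sum-δℕ i) (sym (sum-δℕ j))) line (trace split)) split
  where
  split : μ ≋ unit i j ⊕ (μ ⊖ unit i j)
  split = ⊖-split (record { col≤ = δℕ-≤ (col μ) 0<cⱼ ; row≤ = δℕ-≤ (row μ) 0<rᵢ ; tr≤ = δᵢⱼ≤t })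
  on-line : ∀ {m} → 1 + δℕ i j ≡ δℕ i m + δℕ j m →
    row μ m + col μ m + (1 + δℕ i j) ≤ mass μ + tr μ + (δℕ i m + δℕ j m)
  on-line {m} eq = subst (λ x → row μ m + col μ m + (1 + δℕ i j) ≤ mass μ + tr μ + x) eq
    (+-monoˡ-≤ (1 + δℕ i j) (line-bound μ-feasible m))
  line : ∀ m → row μ m + col μ m + (sum (δℕ j) + δℕ i j) ≤ mass μ + tr μ + (δℕ i m + δℕ j m)
  line m rewrite sum-δℕ j with m ≟ i | m ≟ j
  ... | yes refl | _        = on-line (cong₂ _+_ (sym (δℕ-refl m)) (δℕ-sym m j))
  ... | no  _    | yes refl = on-line (trans (+-comm 1 (δℕ i m)) (cong (δℕ i m +_) (sym (δℕ-refl m))))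
  ... | no  m≢i  | no  m≢j  rewrite δℕ-≢ (m≢i ∘ sym) | δℕ-≢ (m≢j ∘ sym) =
    subst (row μ m + col μ m + (1 + δℕ i j) ≤_) (sym (+-identityʳ _)) (others m m≢i m≢j)

peel-pair : Feasible μ → tr μ ≡ 1 → k ≢ l →
  0 < row μ k → 0 < row μ l → 0 < col μ k → 0 < col μ l →
  row μ k + col μ k ≤ mass μ → row μ l + col μ l ≤ mass μ →
  (∀ m → m ≢ k → m ≢ l → row μ m + col μ m + 3 ≤ mass μ + 1) → Peeling μ
peel-pair {μ = μ} {k = k} {l = l} μ-feasible t≡1 k≢l 0<rₖ 0<rₗ 0<cₖ 0<cₗ kₖ≤n lₗ≤n others =
  peeling (pair-gen k≢l) (feasible-summand μ-feasible split refl line trace) split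
  where
  split : μ ≋ pair k l ⊕ (μ ⊖ pair k l)
  split = ⊖-split (record
    { col≤ = δℕ₂-≤ (col μ) k≢l 0<cₖ 0<cₗ
    ; row≤ = δℕ₂-≤ (row μ) k≢l 0<rₖ 0<rₗ
    ; tr≤  = ≤-reflexive (sym t≡1) })
  trace : TraceBound (μ ⊖ pair k l)
  trace rewrite t≡1 = z≤n
  on-line : ∀ {m} → row μ m + col μ m ≤ mass μ → δℕ k m + δℕ l m ≡ 1 →
    row μ m + col μ m + (2 + 1) ≤ mass μ + 1 + ((δℕ k m + δℕ l m) + (δℕ k m + δℕ l m))
  on-line {m} le e rewrite e = subst (row μ m + col μ m + 3 ≤_) (sym (+-assoc (mass μ) 1 2)) (+-monoˡ-≤ 3 le)
  line : ∀ m → row μ m + col μ m + (sum (λ m → δℕ k m + δℕ l m) + 1) ≤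
               mass μ + tr μ + ((δℕ k m + δℕ l m) + (δℕ k m + δℕ l m))
  line m rewrite sum-pair k l | t≡1 with m ≟ k | m ≟ l
  ... | yes refl | _        = on-line kₖ≤n (cong₂ _+_ (δℕ-refl m) (δℕ-≢ (k≢l ∘ sym)))
  ... | no  _    | yes refl = on-line lₗ≤n (cong₂ _+_ (δℕ-≢ k≢l) (δℕ-refl m))
  ... | no  m≢k  | no  m≢l  rewrite δℕ-≢ (m≢k ∘ sym) | δℕ-≢ (m≢l ∘ sym) =
    subst (row μ m + col μ m + 3 ≤_) (sym (+-identityʳ _)) (others m m≢k m≢l)

peel-diagonal : Feasible μ → 0 < tr μ → 0 < row μ k → 0 < col μ k →
  (∀ m → m ≢ k → row μ m + col μ m + 1 < mass μ + tr μ) → Peeling μ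
peel-diagonal {μ = μ} {k = k} μ-feasible 0<t 0<rₖ 0<cₖ others =
  peel-unit μ-feasible 0<rₖ 0<cₖ (subst (_≤ tr μ) (sym (δℕ-refl k)) 0<t)
    (λ m m≢k _ → subst₂ (λ x y → row μ m + col μ m + (1 + x) ≤ y) (sym (δℕ-refl k)) refl
      (subst (_≤ mass μ + tr μ) (sym (+-suc (row μ m + col μ m) 1)) (others m m≢k)))
    trace
  where
  trace : ∀ {ν} → μ ≋ unit k k ⊕ ν → TraceBound ν
  trace {ν} split = +-cancelˡ-≤ 1 _ _ (begin
    1 + tr ν         ≡⟨ cong (_+ tr ν) (δℕ-refl k) ⟨
    δℕ k k + tr ν    ≡⟨ tr≡ split ⟨
    tr μ             ≤⟨ trace-bound μ-feasible ⟩
    maxTrace μ       ≡⟨ maxTrace-diagonal {k = k} split ⟩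
    1 + maxTrace ν   ∎)
    where open ℕ.≤-Reasoning

line+1≤sum+sum⊓ : (f g : Fin n → ℕ) {m i : Fin n} → m ≢ i → g m ≤ f m → 0 < f i →
  f m + g m + 1 ≤ sum f + sum (λ k → f k ⊓ g k)
line+1≤sum+sum⊓ f g {m} {i} m≢i gₘ≤fₘ 0<fᵢ = begin
  f m + g m + 1                             ≡⟨ cong (λ x → f m + x + 1) (m≥n⇒m⊓n≡n gₘ≤fₘ) ⟨
  (f m + f m ⊓ g m) + 1                     ≤⟨ +-monoʳ-≤ _ (≤-trans 0<fᵢ (m≤m+n (f i) _)) ⟩
  (f m + f m ⊓ g m) + (f i + f i ⊓ g i)     ≤⟨ ≤-sum₂ (λ k → f k + f k ⊓ g k) m≢i ⟩
  sum (λ k → f k + f k ⊓ g k)               ≡⟨ ∑-distrib-+ f _ ⟩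
  sum f + sum (λ k → f k ⊓ g k)             ∎
  where open ℕ.≤-Reasoning

⊓-≤-remainder : (f g f′ : Fin n → ℕ) {i : Fin n} → f ≗ (λ m → δℕ i m + f′ m) → g i < f i →
  ∀ m → f m ⊓ g m ≤ f′ m
⊓-≤-remainder f g f′ {i} f≗ gᵢ<fᵢ m with i ≟ m
... | yes refl = ≤-trans (m⊓n≤n (f m) (g m))
                   (≤-pred (≤-trans gᵢ<fᵢ (≤-reflexive (trans (f≗ m) (cong (_+ f′ m) (δℕ-refl m))))))
... | no  i≢m  = ≤-trans (m⊓n≤m (f m) (g m)) (≤-reflexive (trans (f≗ m) (cong (_+ f′ m) (δℕ-≢ i≢m))))

peel-tight-off-diagonal : Feasible μ → maxTrace μ ≤ tr μ → col μ i < row μ i → row μ j < col μ j → Peeling μ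
peel-tight-off-diagonal {μ = μ} {i = i} {j = j} μ-feasible tight cᵢ<rᵢ rⱼ<cⱼ =
  peel-unit μ-feasible 0<rᵢ 0<cⱼ (subst (_≤ tr μ) (sym (δℕ-≢ i≢j)) z≤n) others trace
  where
  open ℕ.≤-Reasoning
  i≢j : i ≢ j
  i≢j refl = ℕ.<-asym cᵢ<rᵢ rⱼ<cⱼ
  0<rᵢ = ≤-trans (s≤s z≤n) cᵢ<rᵢ
  0<cⱼ = ≤-trans (s≤s z≤n) rⱼ<cⱼ
  others : ∀ m → m ≢ i → m ≢ j → row μ m + col μ m + (1 + δℕ i j) ≤ mass μ + tr μ
  others m m≢i m≢j rewrite δℕ-≢ i≢j with ≤-total (col μ m) (row μ m)
  ... | inj₁ cₘ≤rₘ = begin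
    row μ m + col μ m + 1                 ≤⟨ line+1≤sum+sum⊓ (row μ) (col μ) m≢i cₘ≤rₘ 0<rᵢ ⟩
    sum (row μ) + maxTrace μ              ≡⟨ cong (_+ maxTrace μ) (balanced μ-feasible) ⟩
    mass μ + maxTrace μ                   ≤⟨ +-monoʳ-≤ (mass μ) tight ⟩
    mass μ + tr μ                         ∎
  ... | inj₂ rₘ≤cₘ = begin
    row μ m + col μ m + 1                 ≡⟨ cong (_+ 1) (+-comm (row μ m) (col μ m)) ⟩
    col μ m + row μ m + 1                 ≤⟨ line+1≤sum+sum⊓ (col μ) (row μ) m≢j rₘ≤cₘ 0<cⱼ ⟩
    mass μ + sum (λ k → col μ k ⊓ row μ k) ≡⟨ cong (mass μ +_) (sum-cong-≗ (λ k → ⊓-comm (col μ k) (row μ k))) ⟩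
    mass μ + maxTrace μ                   ≤⟨ +-monoʳ-≤ (mass μ) tight ⟩
    mass μ + tr μ                         ∎
  trace : ∀ {ν} → μ ≋ unit i j ⊕ ν → TraceBound ν
  trace {ν} split = begin
    tr ν            ≡⟨ cong (_+ tr ν) (δℕ-≢ i≢j) ⟨
    δℕ i j + tr ν   ≡⟨ tr≡ split ⟨
    tr μ            ≤⟨ trace-bound μ-feasible ⟩
    maxTrace μ      ≤⟨ sum-mono-≤ (λ m → ⊓-glb (⊓-≤-remainder (row μ) (col μ) (row ν) (row≗ split) cᵢ<rᵢ m)
                         (subst (_≤ col ν m) (⊓-comm (col μ m) (row μ m))
                           (⊓-≤-remainder (col μ) (row μ) (col ν) (col≗ split) rⱼ<cⱼ m))) ⟩
    maxTrace ν      ∎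

peel-tight-diagonal : Feasible μ → 0 < mass μ → maxTrace μ ≤ tr μ → row μ ≗ col μ → Peeling μ
peel-tight-diagonal {μ = μ} μ-feasible 0<n tight r≗c
  with sum-positive (row μ) (subst (0 <_) (sym (balanced μ-feasible)) 0<n)
... | z , 0<r_z = peel-diagonal μ-feasible (≤-trans 0<n n≤t) 0<r_z (subst (0 <_) (r≗c z) 0<r_z) others
  where
  open ℕ.≤-Reasoning
  n≤t : mass μ ≤ tr μ
  n≤t = ≤-trans (≤-reflexive (sum-cong-≗ (λ m → trans (sym (⊓-idem (col μ m))) (cong (_⊓ col μ m) (sym (r≗c m))))))
          tight
  double+1 : ∀ x → suc (x + x + 1) ≡ (x + 1) + (x + 1)
  double+1 = solve-∀
  others : ∀ m → m ≢ z → row μ m + col μ m + 1 < mass μ + tr μ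
  others m m≢z = begin-strict
    row μ m + col μ m + 1          ≡⟨ cong (λ x → row μ m + x + 1) (r≗c m) ⟨
    row μ m + row μ m + 1          <⟨ ≤-reflexive (double+1 (row μ m)) ⟩
    (row μ m + 1) + (row μ m + 1)  ≤⟨ +-mono-≤ rₘ+1≤n rₘ+1≤n ⟩
    mass μ + mass μ                ≤⟨ +-monoʳ-≤ (mass μ) n≤t ⟩
    mass μ + tr μ                  ∎
    where
    rₘ+1≤n : row μ m + 1 ≤ mass μ
    rₘ+1≤n = ≤-trans (+-monoʳ-≤ (row μ m) 0<r_z) (row₂≤mass μ-feasible m≢z)

peel-tight : Feasible μ → 0 < mass μ → maxTrace μ ≤ tr μ → Peeling μ
peel-tight {μ = μ} μ-feasible 0<n tight with any? (λ i → col μ i ℕ.<? row μ i)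
... | yes (i , cᵢ<rᵢ) =
  let j , rⱼ<cⱼ = sum-surplus {f = row μ} {g = col μ} (balanced μ-feasible) cᵢ<rᵢ
  in peel-tight-off-diagonal μ-feasible tight cᵢ<rᵢ rⱼ<cⱼ
... | no ∄ = peel-tight-diagonal μ-feasible 0<n tight
  (sum-≤-≗ (λ m → ≮⇒≥ (λ cₘ<rₘ → ∄ (m , cₘ<rₘ))) (balanced μ-feasible))

peel-traceless-off-diagonal : Feasible μ → tr μ ≡ 0 → i ≢ j → 0 < row μ i → 0 < col μ j →
  (∀ m → m ≢ i → m ≢ j → row μ m + col μ m < mass μ) → Peeling μ
peel-traceless-off-diagonal {μ = μ} {i = i} {j = j} μ-feasible t≡0 i≢j 0<rᵢ 0<cⱼ others =
  peel-unit μ-feasible 0<rᵢ 0<cⱼ (subst (_≤ tr μ) (sym (δℕ-≢ i≢j)) z≤n) line trace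
  where
  line : ∀ m → m ≢ i → m ≢ j → row μ m + col μ m + (1 + δℕ i j) ≤ mass μ + tr μ
  line m m≢i m≢j rewrite δℕ-≢ i≢j | t≡0 = subst₂ _≤_ (+-comm 1 _) (sym (+-identityʳ _)) (others m m≢i m≢j)
  trace : ∀ {ν} → μ ≋ unit i j ⊕ ν → TraceBound ν
  trace {ν} split = subst (_≤ maxTrace ν) (trans (sym t≡0) (trans (tr≡ split) (cong (_+ tr ν) (δℕ-≢ i≢j)))) z≤n

col<mass : Feasible μ → tr μ ≡ 0 → 0 < row μ k → col μ k < mass μ
col<mass {μ = μ} {k = k} μ-feasible t≡0 0<rₖ =
  ≤-trans (+-monoˡ-≤ (col μ k) 0<rₖ)
    (≤-trans (line-bound μ-feasible k) (≤-reflexive (trans (cong (mass μ +_) t≡0) (+-identityʳ _))))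

peel-traceless : Feasible μ → 0 < mass μ → tr μ ≡ 0 → Peeling μ
peel-traceless {μ = μ} μ-feasible 0<n t≡0 with occurrences (λ m → mass μ ℕ.≤? row μ m + col μ m)
... | none loose =
  let i , 0<rᵢ      = sum-positive (row μ) 0<Σr
      j , j≢i , 0<cⱼ = sum-positive-elsewhere (col μ) i (col<mass μ-feasible t≡0 0<rᵢ)
  in peel-traceless-off-diagonal μ-feasible t≡0 (j≢i ∘ sym) 0<rᵢ 0<cⱼ (λ m _ _ → ≰⇒> (loose m))
  where 0<Σr = subst (0 <_) (sym (balanced μ-feasible)) 0<n
... | one z full-z loose with 0 ℕ.<? row μ z
...   | yes 0<r_z =
  let j , j≢z , 0<cⱼ = sum-positive-elsewhere (col μ) z (col<mass μ-feasible t≡0 0<r_z)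
  in peel-traceless-off-diagonal μ-feasible t≡0 (j≢z ∘ sym) 0<r_z 0<cⱼ (λ m m≢z _ → ≰⇒> (loose m m≢z))
...   | no ¬0<r_z =
  let i , i≢z , 0<rᵢ = sum-positive-elsewhere (row μ) z
                          (subst₂ _<_ (sym (≯0⇒≡0 ¬0<r_z)) (sym (balanced μ-feasible)) 0<n)
  in peel-traceless-off-diagonal μ-feasible t≡0 i≢z 0<rᵢ 0<c_z (λ m _ m≢z → ≰⇒> (loose m m≢z))
  where 0<c_z = ≤-trans 0<n (subst (λ x → mass μ ≤ x + col μ z) (≯0⇒≡0 ¬0<r_z) full-z)
peel-traceless {μ = μ} μ-feasible 0<n t≡0 | two {z} {w} z≢w full-z full-w with 0 ℕ.<? row μ z
... | yes 0<r_z = peel-traceless-off-diagonal μ-feasible t≡0 z≢w 0<r_z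
  (≤-trans 0<r_z (cross-≤ (row₂≤mass μ-feasible z≢w) full-w)) others
  where
  others : ∀ m → m ≢ z → m ≢ w → row μ m + col μ m < mass μ
  others m m≢z m≢w = subst (_< mass μ) (sym (others-vanish μ-feasible z≢w full-z full-w m m≢z m≢w)) 0<n
... | no ¬0<r_z = peel-traceless-off-diagonal μ-feasible t≡0 (z≢w ∘ sym)
  (≤-trans 0<c_z (cross-≤ (≤-sum₂ (col μ) z≢w) (subst (mass μ ≤_) (+-comm (row μ w) (col μ w)) full-w)))
  0<c_z
  (λ m m≢w m≢z → subst (_< mass μ) (sym (others-vanish μ-feasible z≢w full-z full-w m m≢z m≢w)) 0<n)
  where 0<c_z = ≤-trans 0<n (subst (λ x → mass μ ≤ x + col μ z) (≯0⇒≡0 ¬0<r_z) full-z)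

two-near-full-lines⇒tr≤1 : Feasible μ → k ≢ l →
  mass μ + tr μ ≤ row μ k + col μ k + 1 → mass μ + tr μ ≤ row μ l + col μ l + 1 → tr μ ≤ 1
two-near-full-lines⇒tr≤1 {μ = μ} {k = k} {l = l} μ-feasible k≢l near-k near-l =
  half (+-cancelˡ-≤ (mass μ + mass μ) (tr μ + tr μ) 2 (begin
    (mass μ + mass μ) + (tr μ + tr μ)              ≡⟨ interchange (mass μ) (mass μ) (tr μ) (tr μ) ⟩
    (mass μ + tr μ) + (mass μ + tr μ)              ≤⟨ +-mono-≤ near-k near-l ⟩
    (row μ k + col μ k + 1) + (row μ l + col μ l + 1)
                                                   ≡⟨ interchange (row μ k + col μ k) 1 (row μ l + col μ l) 1 ⟩
    (row μ k + col μ k) + (row μ l + col μ l) + 2  ≤⟨ +-monoˡ-≤ 2 (two-lines-≤ μ-feasible k≢l) ⟩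
    (mass μ + mass μ) + 2                          ∎))
  where
  open ℕ.≤-Reasoning
  interchange : ∀ w x y z → (w + x) + (y + z) ≡ (w + y) + (x + z)
  interchange = solve-∀
  half : ∀ {t} → t + t ≤ 2 → t ≤ 1
  half {zero}        _ = z≤n
  half {suc zero}    _ = s≤s z≤n
  half {suc (suc t)} (s≤s (s≤s t+2+t≤0)) = contradiction (n≤0⇒n≡0 t+2+t≤0) (ℕ.m+1+n≢0 t)

peel-two-full-lines : Feasible μ → tr μ ≡ 1 → k ≢ l → mass μ ≤ row μ k + col μ k → mass μ ≤ row μ l + col μ l →
  0 < maxTrace μ → Peeling μ
peel-two-full-lines {μ = μ} {k = k} {l = l} μ-feasible t≡1 k≢l n≤k n≤l 0<M =
  peel-pair μ-feasible t≡1 k≢l 0<rₖ 0<rₗ 0<cₖ 0<cₗ (k≤n) (l≤n) others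
  where
  vanish = others-vanish μ-feasible k≢l n≤k n≤l
  k≤n : row μ k + col μ k ≤ mass μ
  k≤n = +-cancelʳ-≤ _ _ _ (≤-trans (+-monoʳ-≤ _ n≤l) (two-lines-≤ μ-feasible k≢l))
  l≤n : row μ l + col μ l ≤ mass μ
  l≤n = +-cancelˡ-≤ _ _ _ (≤-trans (+-monoˡ-≤ _ n≤k) (two-lines-≤ μ-feasible k≢l))
  flip : ∀ {m} → mass μ ≤ row μ m + col μ m → mass μ ≤ col μ m + row μ m
  flip {m} = subst (mass μ ≤_) (+-comm (row μ m) (col μ m))
  rₖ≡cₗ : row μ k ≡ col μ l
  rₖ≡cₗ = ≤-antisym (cross-≤ (row₂≤mass μ-feasible k≢l) n≤l) (cross-≤ (≤-sum₂ (col μ) (k≢l ∘ sym)) (flip n≤k))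
  rₗ≡cₖ : row μ l ≡ col μ k
  rₗ≡cₖ = ≤-antisym (cross-≤ (row₂≤mass μ-feasible (k≢l ∘ sym)) n≤k) (cross-≤ (≤-sum₂ (col μ) k≢l) (flip n≤l))
  minₗ≡minₖ : row μ l ⊓ col μ l ≡ row μ k ⊓ col μ k
  minₗ≡minₖ = trans (cong₂ _⊓_ rₗ≡cₖ (sym rₖ≡cₗ)) (⊓-comm (col μ k) (row μ k))
  0<minₖ : 0 < row μ k ⊓ col μ k
  0<minₖ with sum-positive (λ m → row μ m ⊓ col μ m) 0<M
  ... | m , 0<minₘ with m ≟ k | m ≟ l
  ...   | yes refl | _        = 0<minₘ
  ...   | no  _    | yes refl = subst (0 <_) minₗ≡minₖ 0<minₘ
  ...   | no  m≢k  | no  m≢l  =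
    contradiction (≤-trans 0<minₘ (≤-trans (m⊓n≤m+n (row μ m) (col μ m)) (≤-reflexive (vanish m m≢k m≢l)))) λ ()
  0<rₖ = ≤-trans 0<minₖ (m⊓n≤m (row μ k) (col μ k))
  0<cₖ = ≤-trans 0<minₖ (m⊓n≤n (row μ k) (col μ k))
  0<rₗ = subst (0 <_) (sym rₗ≡cₖ) 0<cₖ
  0<cₗ = subst (0 <_) rₖ≡cₗ 0<rₖ
  others : ∀ m → m ≢ k → m ≢ l → row μ m + col μ m + 3 ≤ mass μ + 1
  others m m≢k m≢l rewrite vanish m m≢k m≢l =
    +-monoˡ-≤ 1 (≤-trans (+-mono-≤ 0<rₖ 0<rₗ) (row₂≤mass μ-feasible k≢l))

peel-slack : Feasible μ → 0 < tr μ → tr μ < maxTrace μ → Peeling μ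
peel-slack {μ = μ} μ-feasible 0<t t<M with occurrences (λ m → mass μ + tr μ ℕ.≤? row μ m + col μ m + 1)
... | none loose =
  let z , 0<min = sum-positive (λ m → row μ m ⊓ col μ m) (≤-trans (s≤s z≤n) t<M)
  in peel-diagonal μ-feasible 0<t (≤-trans 0<min (m⊓n≤m _ _)) (≤-trans 0<min (m⊓n≤n _ _)) (λ m _ → ≰⇒> (loose m))
... | one z near-z loose = peel-diagonal μ-feasible 0<t
  (positive-on-full-line (row μ) (col μ) z full-z 0<M)
  (positive-on-full-line (col μ) (row μ) z
    (≤-trans (≤-reflexive (balanced μ-feasible)) (subst (mass μ ≤_) (+-comm (row μ z) (col μ z)) full-z))
    (subst (0 <_) (sum-cong-≗ (λ m → ⊓-comm (row μ m) (col μ m))) 0<M))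
  (λ m m≢z → ≰⇒> (loose m m≢z))
  where
  0<M = ≤-trans (s≤s z≤n) t<M
  full-z : mass μ ≤ row μ z + col μ z
  full-z = +-cancelʳ-≤ 1 _ _ (≤-trans (+-monoʳ-≤ (mass μ) 0<t) near-z)
... | two z≢w near-z near-w =
  peel-two-full-lines μ-feasible t≡1 z≢w (full near-z) (full near-w) (≤-trans (s≤s z≤n) t<M)
  where
  t≡1 : tr μ ≡ 1
  t≡1 = ≤-antisym (two-near-full-lines⇒tr≤1 μ-feasible z≢w near-z near-w) 0<t
  full : ∀ {m} → mass μ + tr μ ≤ row μ m + col μ m + 1 → mass μ ≤ row μ m + col μ m
  full near = +-cancelʳ-≤ 1 _ _ (≤-trans (+-monoʳ-≤ (mass μ) 0<t) near)

peel : Feasible μ → 0 < mass μ → Peeling μ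
peel {μ = μ} μ-feasible 0<n with tr μ ℕ.≟ 0 | maxTrace μ ℕ.≤? tr μ
... | yes t≡0 | _         = peel-traceless μ-feasible 0<n t≡0
... | no  t≢0 | yes tight = peel-tight μ-feasible 0<n tight
... | no  t≢0 | no  slack = peel-slack μ-feasible (n≢0⇒n>0 t≢0) (≰⇒> slack)

-- Irreducibility of the generators

traceless-half : {k l : Fin d} {μ ν : Margins d} → pair k l ≋ μ ⊕ ν → Feasible μ → Feasible ν →
  mass μ ≡ 1 → tr μ ≡ 0 → tr ν ≡ 0
traceless-half {k = k} {l} {μ} {ν} split μ-feasible ν-feasible n≡1 t≡0 =
  n≤0⇒n≡0 (≤-trans (trace-bound ν-feasible) (+-cancelˡ-≤ 2 _ 0 (begin
    2 + maxTrace ν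
      ≡⟨ cong₂ (λ p q → p + q + maxTrace ν) (trans (balanced μ-feasible) n≡1) n≡1 ⟨
    sum (row μ) + sum (col μ) + maxTrace ν
      ≡⟨ cong (_+ maxTrace ν) (∑-distrib-+ (row μ) (col μ)) ⟨
    sum (λ m → row μ m + col μ m) + maxTrace ν
      ≡⟨ ∑-distrib-+ (λ m → row μ m + col μ m) (λ m → row ν m ⊓ col ν m) ⟨
    sum (λ m → row μ m + col μ m + row ν m ⊓ col ν m)
      ≤⟨ sum-mono-≤ pointwise ⟩
    sum (λ m → δℕ k m + δℕ l m)
      ≡⟨ sum-pair k l ⟩
    2 ∎)))
  where
  open ℕ.≤-Reasoning
  pointwise : ∀ m → row μ m + col μ m + row ν m ⊓ col ν m ≤ δℕ k m + δℕ l m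
  pointwise m = disjoint+⊓≤ {row μ m} {col μ m} {row ν m} {col ν m} (sym (row≗ split m)) (sym (col≗ split m))
    (≤-trans (line-bound μ-feasible m) (≤-reflexive (cong₂ _+_ n≡1 t≡0)))

generator-irreducible : {γ μ ν : Margins d} → IsGenerator γ → γ ≋ μ ⊕ ν → Feasible μ → Feasible ν →
  mass μ ≡ 0 ⊎ mass ν ≡ 0
generator-irreducible {γ = γ} {μ} {ν} γ-generator split μ-feasible ν-feasible
  with mass μ ℕ.≟ 0 | mass ν ℕ.≟ 0
... | yes μ≡0 | _       = inj₁ μ≡0
... | no  _   | yes ν≡0 = inj₂ ν≡0
... | no  μ≢0 | no  ν≢0 = contradiction γ-generator (both-positive (n≢0⇒n>0 μ≢0) (n≢0⇒n>0 ν≢0))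
  where
  total : mass γ ≡ mass μ + mass ν
  total = mass-split {γ = μ} split
  both-positive : 0 < mass μ → 0 < mass ν → ¬ IsGenerator γ
  both-positive 0<μ 0<ν (unit-gen i j) =
    contradiction (≤-trans (+-mono-≤ 0<μ 0<ν) (≤-reflexive (trans (sym total) (sum-δℕ j)))) λ { (s≤s ()) }
  both-positive 0<μ 0<ν (pair-gen {k} {l} k≢l) =
    [ (λ tμ≡0 → 0≢1 (cong₂ _+_ tμ≡0 (traceless-half {k = k} {l} split μ-feasible ν-feasible μ≡1 tμ≡0)))
    , (λ tν≡0 → 0≢1 (cong₂ _+_ (traceless-half {k = k} {l} (≋-trans split (⊕-comm μ ν))
                                  ν-feasible μ-feasible ν≡1 tν≡0) tν≡0))
    ]′ (one-summand-zero traces)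
    where
    traces : tr μ + tr ν ≡ 1
    traces = sym (tr≡ split)
    0≢1 : tr μ + tr ν ≡ 0 + 0 → ⊥
    0≢1 t≡0 = contradiction (trans (sym t≡0) traces) λ ()
    masses = both-one (trans (sym total) (sum-pair k l)) 0<μ 0<ν
    μ≡1 = proj₁ masses
    ν≡1 = proj₂ masses

-- Nonnegative rational matrices with prescribed margins

toℚ-mkℚ : ∀ z → toℚ z ≡ mkℚ z 0 (Coprime.sym (1-coprimeTo ℤ.∣ z ∣))
toℚ-mkℚ z = ℚ.↥p/↧p≡p _

toℚ-+ : ∀ a b → toℚ (a ℤ.+ b) ≡ toℚ a ℚ.+ toℚ b
toℚ-+ a b rewrite toℚ-mkℚ a | toℚ-mkℚ b =
  cong (ℚ._/ 1) (sym (cong₂ ℤ._+_ (ℤ.*-identityʳ a) (ℤ.*-identityʳ b)))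

toℚ-mono-≤ : ∀ {a b} → a ℤ.≤ b → toℚ a ℚ.≤ toℚ b
toℚ-mono-≤ {a} {b} a≤b rewrite toℚ-mkℚ a | toℚ-mkℚ b =
  ℚ.*≤* (subst₂ ℤ._≤_ (sym (ℤ.*-identityʳ a)) (sym (ℤ.*-identityʳ b)) a≤b)

toℚ-cancel-≤ : ∀ {a b} → toℚ a ℚ.≤ toℚ b → a ℤ.≤ b
toℚ-cancel-≤ {a} {b} a≤b rewrite toℚ-mkℚ a | toℚ-mkℚ b =
  subst₂ ℤ._≤_ (ℤ.*-identityʳ a) (ℤ.*-identityʳ b) (ℚ.drop-*≤* a≤b)

toℚ-injective : ∀ {a b} → toℚ a ≡ toℚ b → a ≡ b
toℚ-injective a≡b = ℤ.≤-antisym (toℚ-cancel-≤ (ℚ.≤-reflexive a≡b)) (toℚ-cancel-≤ (ℚ.≤-reflexive (sym a≡b)))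

ι : ℕ → ℚ
ι n = toℚ (ℤ.+ n)

ι-+ : ∀ m n → ι (m + n) ≡ ι m ℚ.+ ι n
ι-+ m n = toℚ-+ (ℤ.+ m) (ℤ.+ n)

ι-mono-≤ : ∀ {m n} → m ≤ n → ι m ℚ.≤ ι n
ι-mono-≤ = toℚ-mono-≤ ∘ +≤+

ι-cancel-≤ : ∀ {m n} → ι m ℚ.≤ ι n → m ≤ n
ι-cancel-≤ = ℤ.drop‿+≤+ ∘ toℚ-cancel-≤

ι-injective : ∀ {m n} → ι m ≡ ι n → m ≡ n
ι-injective = ℤ.+-injective ∘ toℚ-injective

ι-nonNeg : ∀ n → NonNegative (ι n)
ι-nonNeg n = ℚ.normalize-nonNeg n 1

½*[q+q]≡q : ∀ q → ½ ℚ.* (q ℚ.+ q) ≡ q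
½*[q+q]≡q q = begin
  ½ ℚ.* (q ℚ.+ q)        ≡⟨ ℚ.*-distribˡ-+ ½ q q ⟩
  ½ ℚ.* q ℚ.+ ½ ℚ.* q    ≡⟨ ℚ.*-distribʳ-+ q ½ ½ ⟨
  (½ ℚ.+ ½) ℚ.* q        ≡⟨ ℚ.*-identityˡ q ⟩
  q                      ∎
  where open ≡-Reasoning

ι-sum : (f : Fin n → ℕ) → ι (sum f) ≡ ∑ℚ (ι ∘ f)
ι-sum {zero}  f = refl
ι-sum {suc n} f = trans (ι-+ (f Fin.zero) _) (cong (ι (f Fin.zero) ℚ.+_) (ι-sum (f ∘ Fin.suc)))

∑≡∑ℚ : (f : Fin n → ℚ) → ∑ f ≡ ∑ℚ f
∑≡∑ℚ {zero}  f = refl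
∑≡∑ℚ {suc n} f = cong (f Fin.zero ℚ.+_) (∑≡∑ℚ (f ∘ Fin.suc))

∑ℚ-mono-≤ : {f g : Fin n → ℚ} → (∀ k → f k ℚ.≤ g k) → ∑ℚ f ℚ.≤ ∑ℚ g
∑ℚ-mono-≤ {zero}  f≤g = ℚ.≤-refl
∑ℚ-mono-≤ {suc n} f≤g = ℚ.+-mono-≤ (f≤g Fin.zero) (∑ℚ-mono-≤ (f≤g ∘ Fin.suc))

∑ℚ-nonneg : (f : Fin n → ℚ) → (∀ k → 0ℚ ℚ.≤ f k) → 0ℚ ℚ.≤ ∑ℚ f
∑ℚ-nonneg {n} f f≥0 = ℚ.≤-trans (ℚ.≤-reflexive (sym (∑ℚ-zero n))) (∑ℚ-mono-≤ f≥0)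

≤-∑ℚ : (f : Fin n → ℚ) → (∀ k → 0ℚ ℚ.≤ f k) → ∀ z → f z ℚ.≤ ∑ℚ f
≤-∑ℚ {suc n} f f≥0 z = begin
  f z                            ≡⟨ ℚ.+-identityʳ (f z) ⟨
  f z ℚ.+ 0ℚ                     ≡⟨ cong (f z ℚ.+_) (∑ℚ-zero n) ⟨
  f z ℚ.+ ∑ℚ {n} (λ _ → 0ℚ)      ≤⟨ ℚ.+-monoʳ-≤ (f z) (∑ℚ-mono-≤ (f≥0 ∘ punchIn z)) ⟩
  f z ℚ.+ ∑ℚ (f ∘ punchIn z)     ≡⟨ ∑ℚ-remove f ⟨
  ∑ℚ f                           ∎
  where open ℚ.≤-Reasoning

∑ℚ-δℕ : (f : Fin n → ℚ) (m : Fin n) → ∑ℚ (λ i → f i ℚ.* ι (δℕ i m)) ≡ f m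
∑ℚ-δℕ {suc n} f Fin.zero = begin
  f Fin.zero ℚ.* 1ℚ ℚ.+ ∑ℚ (λ i → f (Fin.suc i) ℚ.* 0ℚ)   ≡⟨ cong₂ ℚ._+_ (ℚ.*-identityʳ (f Fin.zero))
                                                               (trans (∑ℚ-cong {n} (ℚ.*-zeroʳ ∘ f ∘ Fin.suc)) (∑ℚ-zero n)) ⟩
  f Fin.zero ℚ.+ 0ℚ                                      ≡⟨ ℚ.+-identityʳ _ ⟩
  f Fin.zero                                             ∎
  where open ≡-Reasoning
∑ℚ-δℕ {suc n} f (Fin.suc m) = trans (cong₂ ℚ._+_ (ℚ.*-zeroʳ (f Fin.zero)) (∑ℚ-δℕ (f ∘ Fin.suc) m)) (ℚ.+-identityˡ _)

Matrix : ℕ → Set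
Matrix d = Fin d → Fin d → ℚ

colSum : Matrix d → Fin d → ℚ
colSum x m = ∑ℚ (λ i → x i m)

rowSum : Matrix d → Fin d → ℚ
rowSum x m = ∑ℚ (λ j → x m j)

diagSum : Matrix d → ℚ
diagSum x = ∑ℚ (λ i → x i i)

weighted : Matrix d → Matrix d → ℚ
weighted x w = ∑ℚ (λ i → ∑ℚ (λ j → x i j ℚ.* w i j))

weighted-cong : (x : Matrix d) {w w′ : Matrix d} → (∀ i j → w i j ≡ w′ i j) → weighted x w ≡ weighted x w′
weighted-cong x w≡w′ = ∑ℚ-cong (λ i → ∑ℚ-cong (λ j → cong (x i j ℚ.*_) (w≡w′ i j)))

weighted-col : (x : Matrix d) (m : Fin d) → weighted x (λ i j → ι (δℕ j m)) ≡ colSum x m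
weighted-col x m = ∑ℚ-cong (λ i → ∑ℚ-δℕ (x i) m)

weighted-row : (x : Matrix d) (m : Fin d) → weighted x (λ i j → ι (δℕ i m)) ≡ rowSum x m
weighted-row x m = trans (∑ℚ-cong (λ i → sym (*-distribʳ-∑ℚ (ι (δℕ i m)) (x i)))) (∑ℚ-δℕ (rowSum x) m)

weighted-diag : (x : Matrix d) → weighted x (λ i j → ι (δℕ i j)) ≡ diagSum x
weighted-diag x =
  ∑ℚ-cong (λ i → trans (∑ℚ-cong (λ j → cong (λ k → x i j ℚ.* ι k) (δℕ-sym i j))) (∑ℚ-δℕ (x i) i))

weighted-total : (x : Matrix d) → weighted x (λ _ _ → 1ℚ) ≡ ∑ℚ (colSum x)
weighted-total x = trans (∑ℚ-cong (λ i → ∑ℚ-cong (λ j → ℚ.*-identityʳ (x i j)))) (∑ℚ-comm x)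

weighted-+ : (x w w′ : Matrix d) → weighted x (λ i j → w i j ℚ.+ w′ i j) ≡ weighted x w ℚ.+ weighted x w′
weighted-+ x w w′ = trans
  (∑ℚ-cong (λ i → trans (∑ℚ-cong (λ j → ℚ.*-distribˡ-+ (x i j) (w i j) (w′ i j)))
                         (∑ℚ-distrib-+ (λ j → x i j ℚ.* w i j) (λ j → x i j ℚ.* w′ i j))))
  (∑ℚ-distrib-+ (λ i → ∑ℚ (λ j → x i j ℚ.* w i j)) (λ i → ∑ℚ (λ j → x i j ℚ.* w′ i j)))

weighted-mono-≤ : (x : Matrix d) → (∀ i j → NonNegative (x i j)) → {w w′ : Matrix d} →
  (∀ i j → w i j ℚ.≤ w′ i j) → weighted x w ℚ.≤ weighted x w′
weighted-mono-≤ x x≥0 w≤w′ =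
  ∑ℚ-mono-≤ (λ i → ∑ℚ-mono-≤ (λ j → ℚ.*-monoˡ-≤-nonNeg (x i j) {{x≥0 i j}} (w≤w′ i j)))

record Representation (μ : Margins d) : Set where
  field
    matrix   : Matrix d
    nonneg   : ∀ i j → NonNegative (matrix i j)
    col-sums : ∀ m → colSum matrix m ≡ ι (col μ m)
    row-sums : ∀ m → rowSum matrix m ≡ ι (row μ m)
    diag-sum : diagSum matrix ≡ ι (tr μ)

open Representation

module _ {μ : Margins d} (ρ : Representation μ) where

  private
    x = matrix ρ

  representation-balanced : sum (row μ) ≡ mass μ
  representation-balanced = ι-injective (begin
    ι (sum (row μ))         ≡⟨ ι-sum (row μ) ⟩
    ∑ℚ (ι ∘ row μ)          ≡⟨ ∑ℚ-cong (row-sums ρ) ⟨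
    ∑ℚ (rowSum x)           ≡⟨ ∑ℚ-comm x ⟩
    ∑ℚ (colSum x)           ≡⟨ ∑ℚ-cong (col-sums ρ) ⟩
    ∑ℚ (ι ∘ col μ)          ≡⟨ ι-sum (col μ) ⟨
    ι (mass μ)              ∎)
    where open ≡-Reasoning

  -- Weighing x against δᵢₘ + δⱼₘ ≤ 1 + δᵢⱼ: the entry (m,m) is the only one counted twice.
  representation-line-bound : ∀ m → row μ m + col μ m ≤ mass μ + tr μ
  representation-line-bound m = ι-cancel-≤ (begin
    ι (row μ m + col μ m)
      ≡⟨ ι-+ (row μ m) (col μ m) ⟩
    ι (row μ m) ℚ.+ ι (col μ m)
      ≡⟨ cong₂ ℚ._+_ (trans (weighted-row x m) (row-sums ρ m)) (trans (weighted-col x m) (col-sums ρ m)) ⟨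
    weighted x (λ i j → ι (δℕ i m)) ℚ.+ weighted x (λ i j → ι (δℕ j m))
      ≡⟨ weighted-+ x (λ i j → ι (δℕ i m)) (λ i j → ι (δℕ j m)) ⟨
    weighted x (λ i j → ι (δℕ i m) ℚ.+ ι (δℕ j m))
      ≤⟨ weighted-mono-≤ x (nonneg ρ) (λ i j →
           subst₂ ℚ._≤_ (ι-+ (δℕ i m) (δℕ j m)) (ι-+ 1 (δℕ i j)) (ι-mono-≤ (δℕ-line i j m))) ⟩
    weighted x (λ i j → 1ℚ ℚ.+ ι (δℕ i j))
      ≡⟨ weighted-+ x (λ _ _ → 1ℚ) (λ i j → ι (δℕ i j)) ⟩
    weighted x (λ _ _ → 1ℚ) ℚ.+ weighted x (λ i j → ι (δℕ i j))
      ≡⟨ cong₂ ℚ._+_ (trans (weighted-total x) (trans (∑ℚ-cong (col-sums ρ)) (sym (ι-sum (col μ)))))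
                     (trans (weighted-diag x) (diag-sum ρ)) ⟩
    ι (mass μ) ℚ.+ ι (tr μ)
      ≡⟨ ι-+ (mass μ) (tr μ) ⟨
    ι (mass μ + tr μ)
      ∎)
    where open ℚ.≤-Reasoning

  representation-trace-bound : TraceBound μ
  representation-trace-bound = ι-cancel-≤ (begin
    ι (tr μ)                             ≡⟨ diag-sum ρ ⟨
    diagSum x                            ≤⟨ ∑ℚ-mono-≤ diagonal≤ ⟩
    ∑ℚ (λ m → ι (row μ m ⊓ col μ m))     ≡⟨ ι-sum (λ m → row μ m ⊓ col μ m) ⟨
    ι (maxTrace μ)                       ∎)
    where
    open ℚ.≤-Reasoning
    x≥0 : ∀ i j → 0ℚ ℚ.≤ x i j
    x≥0 i j = ℚ.nonNegative⁻¹ (x i j) {{nonneg ρ i j}}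
    diagonal≤ : ∀ m → x m m ℚ.≤ ι (row μ m ⊓ col μ m)
    diagonal≤ m with ≤-total (row μ m) (col μ m)
    ... | inj₁ r≤c = ℚ.≤-trans (≤-∑ℚ (x m) (x≥0 m) m)
                       (ℚ.≤-reflexive (trans (row-sums ρ m) (cong ι (sym (m≤n⇒m⊓n≡m r≤c)))))
    ... | inj₂ c≤r = ℚ.≤-trans (≤-∑ℚ (λ i → x i m) (λ i → x≥0 i m) m)
                       (ℚ.≤-reflexive (trans (col-sums ρ m) (cong ι (sym (m≥n⇒m⊓n≡n c≤r)))))

representation⇒feasible : {μ : Margins d} → Representation μ → Feasible μ
representation⇒feasible ρ = record
  { balanced    = representation-balanced ρ
  ; line-bound  = representation-line-bound ρ
  ; trace-bound = representation-trace-bound ρ }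

representation-≋ : {μ ν : Margins d} → μ ≋ ν → Representation μ → Representation ν
representation-≋ μ≋ν ρ = record
  { matrix   = matrix ρ
  ; nonneg   = nonneg ρ
  ; col-sums = λ m → trans (col-sums ρ m) (cong ι (col≗ μ≋ν m))
  ; row-sums = λ m → trans (row-sums ρ m) (cong ι (row≗ μ≋ν m))
  ; diag-sum = trans (diag-sum ρ) (cong ι (tr≡ μ≋ν)) }

representation-⊕ : {μ ν : Margins d} → Representation μ → Representation ν → Representation (μ ⊕ ν)
representation-⊕ {μ = μ} {ν} ρ σ = record
  { matrix   = λ i j → matrix ρ i j ℚ.+ matrix σ i j
  ; nonneg   = λ i j → ℚ.nonNeg+nonNeg⇒nonNeg (matrix ρ i j) {{nonneg ρ i j}} (matrix σ i j) {{nonneg σ i j}}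
  ; col-sums = λ m → trans (∑ℚ-distrib-+ (λ i → matrix ρ i m) (λ i → matrix σ i m))
                      (trans (cong₂ ℚ._+_ (col-sums ρ m) (col-sums σ m)) (sym (ι-+ (col μ m) (col ν m))))
  ; row-sums = λ m → trans (∑ℚ-distrib-+ (matrix ρ m) (matrix σ m))
                      (trans (cong₂ ℚ._+_ (row-sums ρ m) (row-sums σ m)) (sym (ι-+ (row μ m) (row ν m))))
  ; diag-sum = trans (∑ℚ-distrib-+ (λ i → matrix ρ i i) (λ i → matrix σ i i))
                      (trans (cong₂ ℚ._+_ (diag-sum ρ) (diag-sum σ)) (sym (ι-+ (tr μ) (tr ν)))) }

representation-halve : {μ : Margins d} → Representation (μ ⊕ μ) → Representation μ
representation-halve {μ = μ} ρ = record
  { matrix   = λ i j → ½ ℚ.* matrix ρ i j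
  ; nonneg   = λ i j → ℚ.nonNeg*nonNeg⇒nonNeg ½ {{ℚ.normalize-nonNeg 1 2}} (matrix ρ i j) {{nonneg ρ i j}}
  ; col-sums = λ m → halve (λ i → matrix ρ i m) (col μ m) (col-sums ρ m)
  ; row-sums = λ m → halve (matrix ρ m) (row μ m) (row-sums ρ m)
  ; diag-sum = halve (λ i → matrix ρ i i) (tr μ) (diag-sum ρ) }
  where
  halve : (f : Fin d → ℚ) (a : ℕ) → ∑ℚ f ≡ ι (a + a) → ∑ℚ (λ i → ½ ℚ.* f i) ≡ ι a
  halve f a Σf≡2a =
    trans (sym (*-distribˡ-∑ℚ ½ f)) (trans (cong (½ ℚ.*_) (trans Σf≡2a (ι-+ a a))) (½*[q+q]≡q (ι a)))

representation-zero : Representation (zeroₘ {d})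
representation-zero {d} = record
  { matrix   = λ _ _ → 0ℚ
  ; nonneg   = λ _ _ → ι-nonNeg 0
  ; col-sums = λ _ → ∑ℚ-zero d
  ; row-sums = λ _ → ∑ℚ-zero d
  ; diag-sum = ∑ℚ-zero d }

representation-unit : (i j : Fin d) → Representation (unit i j)
representation-unit i j = record
  { matrix   = λ i′ j′ → ι (δℕ i i′ * δℕ j j′)
  ; nonneg   = λ i′ j′ → ι-nonNeg (δℕ i i′ * δℕ j j′)
  ; col-sums = λ m → trans (sym (ι-sum (λ i′ → δℕ i i′ * δℕ j m))) (cong ι (sum-δℕ-* (λ _ → δℕ j m) i))
  ; row-sums = λ m → trans (sym (ι-sum (λ j′ → δℕ i m * δℕ j j′)))
                       (cong ι (trans (sum-cong-≗ (λ j′ → ℕ.*-comm (δℕ i m) (δℕ j j′))) (sum-δℕ-* (λ _ → δℕ i m) j)))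
  ; diag-sum = trans (sym (ι-sum (λ m → δℕ i m * δℕ j m))) (cong ι (trans (sum-δℕ-* (δℕ j) i) (δℕ-sym j i)))
  }

representation-pair : {k l : Fin d} → k ≢ l → Representation (pair k l)
representation-pair {k = k} {l} k≢l = representation-halve (representation-≋ (pair-double {k = k} k≢l)
  (representation-⊕ (representation-⊕ (representation-⊕ (representation-unit l l) (representation-unit l k))
    (representation-unit k l)) (representation-unit k k)))

generator-representation : {γ : Margins d} → IsGenerator γ → Representation γ
generator-representation (unit-gen i j)  = representation-unit i j
generator-representation (pair-gen k≢l) = representation-pair k≢l

feasible⇒representation : {μ : Margins d} → Feasible μ → Representation μ
feasible⇒representation {μ = μ} μ-feasible = by-mass-bound (mass μ) ≤-refl μ-feasible
  where
  by-mass-bound : ∀ {μ : Margins d} b → mass μ ≤ b → Feasible μ → Representation μ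
  by-mass-bound {μ = μ} b n≤b μ-feasible with mass μ ℕ.≟ 0
  by-mass-bound b       n≤b μ-feasible | yes n≡0 =
    representation-≋ (≋-sym (mass≡0⇒≋zeroₘ μ-feasible n≡0)) representation-zero
  by-mass-bound zero    n≤0 μ-feasible | no  n≢0 = contradiction (n≤0⇒n≡0 n≤0) n≢0
  by-mass-bound (suc b) n≤b μ-feasible | no  n≢0 with peel μ-feasible (n≢0⇒n>0 n≢0)
  ... | peeling {γ} {ν} γ-generator ν-feasible split =
    representation-≋ (≋-sym split)
      (representation-⊕ (generator-representation γ-generator) (by-mass-bound b ν≤b ν-feasible))
    where
    ν≤b : mass ν ≤ b
    ν≤b = ≤-pred (≤-trans (+-monoˡ-≤ (mass ν) (generator-mass γ-generator))
            (≤-trans (≤-reflexive (sym (mass-split {γ = γ} split))) n≤b))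

-- Coordinates of ℤ^(2d+1)

entry : Margins d → Coord d → ℕ
entry {d} μ c = [ [ col μ , row μ ]′ ∘ splitAt d , (λ _ → tr μ) ]′ (splitAt (d + d) c)

⟦_⟧ : Margins d → Coord d → ℤ
⟦ μ ⟧ c = ℤ.+ entry μ c

⟦⟧-col : (μ : Margins d) (m : Fin d) → ⟦ μ ⟧ (colC m) ≡ ℤ.+ col μ m
⟦⟧-col {d} μ m rewrite splitAt-↑ˡ (d + d) (m ↑ˡ d) 1 | splitAt-↑ˡ d m d = refl

⟦⟧-row : (μ : Margins d) (m : Fin d) → ⟦ μ ⟧ (rowC m) ≡ ℤ.+ row μ m
⟦⟧-row {d} μ m rewrite splitAt-↑ˡ (d + d) (d ↑ʳ m) 1 | splitAt-↑ʳ d d m = refl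

⟦⟧-last : (μ : Margins d) → ⟦ μ ⟧ (lastC {d}) ≡ ℤ.+ tr μ
⟦⟧-last {d} μ rewrite splitAt-↑ʳ (d + d) 1 Fin.zero = refl

coord-ext : {A : Set} {u w : Coord d → A} →
  (∀ m → u (colC m) ≡ w (colC m)) → (∀ m → u (rowC m) ≡ w (rowC m)) →
  u (lastC {d}) ≡ w (lastC {d}) → u ≗ w
coord-ext {d} {u = u} {w} on-col on-row on-last c with splitAt (d + d) c in eq₁
... | inj₂ Fin.zero = subst (λ c → u c ≡ w c) (splitAt⁻¹-↑ʳ eq₁) on-last
... | inj₁ k with splitAt d k in eq₂
...   | inj₁ j = subst (λ c → u c ≡ w c) (trans (cong (_↑ˡ 1) (splitAt⁻¹-↑ˡ eq₂)) (splitAt⁻¹-↑ˡ eq₁))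
                   (on-col j)
...   | inj₂ i = subst (λ c → u c ≡ w c) (trans (cong (_↑ˡ 1) (splitAt⁻¹-↑ʳ eq₂)) (splitAt⁻¹-↑ˡ eq₁))
                   (on-row i)

entry-⊕ : (μ ν : Margins d) (c : Coord d) → entry (μ ⊕ ν) c ≡ entry μ c + entry ν c
entry-⊕ {d} μ ν c with splitAt (d + d) c
... | inj₂ _ = refl
... | inj₁ k with splitAt d k
...   | inj₁ _ = refl
...   | inj₂ _ = refl

entry-≋ : μ ≋ ν → entry μ ≗ entry ν
entry-≋ {d} μ≋ν c with splitAt (d + d) c
... | inj₂ _ = tr≡ μ≋ν
... | inj₁ k with splitAt d k
...   | inj₁ j = col≗ μ≋ν j
...   | inj₂ i = row≗ μ≋ν i

⟦⟧-⊕ : (μ ν : Margins d) (c : Coord d) → ⟦ μ ⊕ ν ⟧ c ≡ ⟦ μ ⟧ c ℤ.+ ⟦ ν ⟧ c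
⟦⟧-⊕ μ ν c = cong ℤ.+_ (entry-⊕ μ ν c)

⟦⟧-≋ : μ ≋ ν → ⟦ μ ⟧ ≗ ⟦ ν ⟧
⟦⟧-≋ μ≋ν = cong ℤ.+_ ∘ entry-≋ μ≋ν

⟦⟧-zeroₘ : (c : Coord d) → ⟦ zeroₘ {d} ⟧ c ≡ ℤ.+ 0
⟦⟧-zeroₘ {d} c with splitAt (d + d) c
... | inj₂ _ = refl
... | inj₁ k with splitAt d k
...   | inj₁ _ = refl
...   | inj₂ _ = refl

⟦⟧-split : {γ μ ν : Margins d} → (∀ c → ⟦ γ ⟧ c ≡ ⟦ μ ⟧ c ℤ.+ ⟦ ν ⟧ c) → γ ≋ μ ⊕ ν
⟦⟧-split {d} {γ} {μ} {ν} split = record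
  { col≗ = λ m → ℤ.+-injective
      (trans (sym (⟦⟧-col γ m)) (trans (split (colC m)) (cong₂ ℤ._+_ (⟦⟧-col μ m) (⟦⟧-col ν m))))
  ; row≗ = λ m → ℤ.+-injective
      (trans (sym (⟦⟧-row γ m)) (trans (split (rowC m)) (cong₂ ℤ._+_ (⟦⟧-row μ m) (⟦⟧-row ν m))))
  ; tr≡  = ℤ.+-injective
      (trans (sym (⟦⟧-last γ)) (trans (split (lastC {d})) (cong₂ ℤ._+_ (⟦⟧-last μ) (⟦⟧-last ν))))
  }

δ≡+δℕ : (x y : Fin n) → δ x y ≡ ℤ.+ δℕ x y
δ≡+δℕ x y with x ≟ y
... | yes refl = cong ℤ.+_ (sym (δℕ-refl x))
... | no  x≢y  = cong ℤ.+_ (sym (δℕ-≢ x≢y))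

↑ˡ≢↑ʳ : ∀ {m n} (i : Fin m) (j : Fin n) → i ↑ˡ n ≢ m ↑ʳ j
↑ˡ≢↑ʳ Fin.zero    j ()
↑ˡ≢↑ʳ (Fin.suc i) j eq = ↑ˡ≢↑ʳ i j (suc-injective eq)

colC-injective : ∀ {j m : Fin d} → colC j ≡ colC m → j ≡ m
colC-injective {d} = ↑ˡ-injective d _ _ ∘ ↑ˡ-injective 1 _ _

rowC-injective : ∀ {i m : Fin d} → rowC i ≡ rowC m → i ≡ m
rowC-injective {d} = ↑ʳ-injective d _ _ ∘ ↑ˡ-injective 1 _ _

colC≢rowC : (j i : Fin d) → colC j ≢ rowC i
colC≢rowC j i = ↑ˡ≢↑ʳ j i ∘ ↑ˡ-injective 1 _ _

colC≢lastC : (j : Fin d) → colC j ≢ lastC {d}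
colC≢lastC {d} j = ↑ˡ≢↑ʳ (j ↑ˡ d) Fin.zero

rowC≢lastC : (i : Fin d) → rowC i ≢ lastC {d}
rowC≢lastC {d} i = ↑ˡ≢↑ʳ (d ↑ʳ i) Fin.zero

a≡+ : ∀ d (i j : Fin d) c → a d i j c ≡ ℤ.+ (δℕ (colC j) c + δℕ (rowC i) c + δℕ i j * δℕ (lastC {d}) c)
a≡+ d i j c rewrite δ≡+δℕ (colC j) c | δ≡+δℕ (rowC i) c | δ≡+δℕ i j | δ≡+δℕ (lastC {d}) c =
  cong (λ z → (ℤ.+ (δℕ (colC j) c + δℕ (rowC i) c)) ℤ.+ z) (sym (ℤ.pos-* (δℕ i j) (δℕ (lastC {d}) c)))

a-col : ∀ d (i j m : Fin d) → a d i j (colC m) ≡ ℤ.+ δℕ j m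
a-col d i j m rewrite a≡+ d i j (colC m) | δℕ-injective colC colC-injective j m
  | δℕ-≢ (colC≢rowC m i ∘ sym) | δℕ-≢ (colC≢lastC m ∘ sym) | ℕ.*-zeroʳ (δℕ i j) =
  cong ℤ.+_ (trans (+-identityʳ _) (+-identityʳ _))

a-row : ∀ d (i j m : Fin d) → a d i j (rowC m) ≡ ℤ.+ δℕ i m
a-row d i j m rewrite a≡+ d i j (rowC m) | δℕ-injective rowC rowC-injective i m
  | δℕ-≢ (colC≢rowC j m) | δℕ-≢ (rowC≢lastC m ∘ sym) | ℕ.*-zeroʳ (δℕ i j) =
  cong ℤ.+_ (+-identityʳ _)

a-last : ∀ d (i j : Fin d) → a d i j (lastC {d}) ≡ ℤ.+ δℕ i j
a-last d i j rewrite a≡+ d i j (lastC {d}) | δℕ-≢ (colC≢lastC j) | δℕ-≢ (rowC≢lastC i) | δℕ-refl (lastC {d}) =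
  cong ℤ.+_ (ℕ.*-identityʳ (δℕ i j))

a≗⟦unit⟧ : ∀ d (i j : Fin d) → a d i j ≗ ⟦ unit i j ⟧
a≗⟦unit⟧ d i j = coord-ext
  (λ m → trans (a-col d i j m) (sym (⟦⟧-col (unit i j) m)))
  (λ m → trans (a-row d i j m) (sym (⟦⟧-row (unit i j) m)))
  (trans (a-last d i j) (sym (⟦⟧-last (unit i j))))

h≡⟦pair⟧ : ∀ d {k l : Fin d} → k ≢ l → ∀ c → h d k l c ≡ toℚ (⟦ pair k l ⟧ c)
h≡⟦pair⟧ d {k} {l} k≢l c = begin
  ½ ℚ.* toℚ (a d l l c ℤ.+ a d l k c ℤ.+ a d k l c ℤ.+ a d k k c)  ≡⟨ cong (λ z → ½ ℚ.* toℚ z) four-units ⟩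
  ½ ℚ.* toℚ (p ℤ.+ p)                                              ≡⟨ cong (½ ℚ.*_) (toℚ-+ p p) ⟩
  ½ ℚ.* (toℚ p ℚ.+ toℚ p)                                          ≡⟨ ½*[q+q]≡q (toℚ p) ⟩
  toℚ p                                                            ∎
  where
  open ≡-Reasoning
  p = ⟦ pair k l ⟧ c
  four-units : a d l l c ℤ.+ a d l k c ℤ.+ a d k l c ℤ.+ a d k k c ≡ p ℤ.+ p
  four-units = begin
    a d l l c ℤ.+ a d l k c ℤ.+ a d k l c ℤ.+ a d k k c
      ≡⟨ cong₂ ℤ._+_ (cong₂ ℤ._+_ (cong₂ ℤ._+_ (a≗⟦unit⟧ d l l c) (a≗⟦unit⟧ d l k c)) (a≗⟦unit⟧ d k l c))
                     (a≗⟦unit⟧ d k k c) ⟩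
    ℤ.+ (entry (unit l l) c + entry (unit l k) c + entry (unit k l) c + entry (unit k k) c)
      ≡⟨ cong ℤ.+_ (sym (trans (entry-⊕ (unit l l ⊕ unit l k ⊕ unit k l) (unit k k) c)
                      (cong (_+ entry (unit k k) c) (trans (entry-⊕ (unit l l ⊕ unit l k) (unit k l) c)
                        (cong (_+ entry (unit k l) c) (entry-⊕ (unit l l) (unit l k) c)))))) ⟩
    ⟦ unit l l ⊕ unit l k ⊕ unit k l ⊕ unit k k ⟧ c
      ≡⟨ ⟦⟧-≋ (pair-double k≢l) c ⟩
    ⟦ pair k l ⊕ pair k l ⟧ c
      ≡⟨ ⟦⟧-⊕ (pair k l) (pair k l) c ⟩
    ⟦ pair k l ⟧ c ℤ.+ ⟦ pair k l ⟧ c ∎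

sum-a≡weighted : (x : Matrix d) (c : Coord d) →
  ∑ (λ i → ∑ (λ j → x i j ℚ.* toℚ (a d i j c))) ≡ weighted x (λ i j → toℚ (a d i j c))
sum-a≡weighted x c = trans (∑≡∑ℚ (λ i → ∑ (λ j → x i j ℚ.* toℚ (a _ i j c))))
  (∑ℚ-cong (λ i → ∑≡∑ℚ (λ j → x i j ℚ.* toℚ (a _ i j c))))

module _ (x : Matrix d) where

  weighted-a-col : (m : Fin d) → weighted x (λ i j → toℚ (a d i j (colC m))) ≡ colSum x m
  weighted-a-col m = trans (weighted-cong x (λ i j → cong toℚ (a-col d i j m))) (weighted-col x m)

  weighted-a-row : (m : Fin d) → weighted x (λ i j → toℚ (a d i j (rowC m))) ≡ rowSum x m
  weighted-a-row m = trans (weighted-cong x (λ i j → cong toℚ (a-row d i j m))) (weighted-row x m)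

  weighted-a-last : weighted x (λ i j → toℚ (a d i j (lastC {d}))) ≡ diagSum x
  weighted-a-last = trans (weighted-cong x (λ i j → cong toℚ (a-last d i j))) (weighted-diag x)

Qsat⇒representation : {v : Coord d → ℤ} → Qsat d v → Σ (Margins d) λ μ → v ≗ ⟦ μ ⟧ × Representation μ
Qsat⇒representation {d} {v} (x , x≥0 , v≡) = observed , v≗⟦observed⟧ , record
  { matrix   = x
  ; nonneg   = x≥0
  ; col-sums = λ m → trans (sym (v-at-col m)) (cong toℚ (sym (nonneg-at-col m)))
  ; row-sums = λ m → trans (sym (v-at-row m)) (cong toℚ (sym (nonneg-at-row m)))
  ; diag-sum = trans (sym v-at-last) (cong toℚ (sym nonneg-at-last)) }
  where
  observed : Margins d
  observed = margins (λ m → ℤ.∣ v (colC m) ∣) (λ m → ℤ.∣ v (rowC m) ∣) ℤ.∣ v (lastC {d}) ∣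
  at : ∀ c → toℚ (v c) ≡ weighted x (λ i j → toℚ (a d i j c))
  at c = trans (v≡ c) (sum-a≡weighted x c)
  v-at-col : ∀ m → toℚ (v (colC m)) ≡ colSum x m
  v-at-col m = trans (at (colC m)) (weighted-a-col x m)
  v-at-row : ∀ m → toℚ (v (rowC m)) ≡ rowSum x m
  v-at-row m = trans (at (rowC m)) (weighted-a-row x m)
  v-at-last : toℚ (v (lastC {d})) ≡ diagSum x
  v-at-last = trans (at (lastC {d})) (weighted-a-last x)
  x≥0′ : ∀ i j → 0ℚ ℚ.≤ x i j
  x≥0′ i j = ℚ.nonNegative⁻¹ (x i j) {{x≥0 i j}}
  nonneg-entry : ∀ {c} (s : ℚ) → toℚ (v c) ≡ s → 0ℚ ℚ.≤ s → ℤ.+ ℤ.∣ v c ∣ ≡ v c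
  nonneg-entry s v≡s 0≤s = ℤ.0≤i⇒+∣i∣≡i (toℚ-cancel-≤ (ℚ.≤-trans 0≤s (ℚ.≤-reflexive (sym v≡s))))
  nonneg-at-col : ∀ m → ℤ.+ ℤ.∣ v (colC m) ∣ ≡ v (colC m)
  nonneg-at-col m = nonneg-entry _ (v-at-col m) (∑ℚ-nonneg _ (λ i → x≥0′ i m))
  nonneg-at-row : ∀ m → ℤ.+ ℤ.∣ v (rowC m) ∣ ≡ v (rowC m)
  nonneg-at-row m = nonneg-entry _ (v-at-row m) (∑ℚ-nonneg _ (x≥0′ m))
  nonneg-at-last : ℤ.+ ℤ.∣ v (lastC {d}) ∣ ≡ v (lastC {d})
  nonneg-at-last = nonneg-entry _ v-at-last (∑ℚ-nonneg _ (λ i → x≥0′ i i))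
  v≗⟦observed⟧ : v ≗ ⟦ observed ⟧
  v≗⟦observed⟧ = coord-ext (λ m → trans (sym (nonneg-at-col m)) (sym (⟦⟧-col observed m)))
                    (λ m → trans (sym (nonneg-at-row m)) (sym (⟦⟧-row observed m)))
                    (trans (sym nonneg-at-last) (sym (⟦⟧-last observed)))

representation⇒Qsat : {μ : Margins d} {v : Coord d → ℤ} → v ≗ ⟦ μ ⟧ → Representation μ → Qsat d v
representation⇒Qsat {d} {μ = μ} {v} v≗⟦μ⟧ ρ =
  matrix ρ , nonneg ρ , λ c → trans (at c) (sym (sum-a≡weighted (matrix ρ) c))
  where
  at : ∀ c → toℚ (v c) ≡ weighted (matrix ρ) (λ i j → toℚ (a d i j c))
  at = coord-ext
    (λ m → trans (cong toℚ (trans (v≗⟦μ⟧ (colC m)) (⟦⟧-col μ m)))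
                 (trans (sym (col-sums ρ m)) (sym (weighted-a-col (matrix ρ) m))))
    (λ m → trans (cong toℚ (trans (v≗⟦μ⟧ (rowC m)) (⟦⟧-row μ m)))
                 (trans (sym (row-sums ρ m)) (sym (weighted-a-row (matrix ρ) m))))
    (trans (cong toℚ (trans (v≗⟦μ⟧ (lastC {d})) (⟦⟧-last μ)))
           (trans (sym (diag-sum ρ)) (sym (weighted-a-last (matrix ρ)))))

Qsat⇒feasible : {v : Coord d → ℤ} → Qsat d v → Σ (Margins d) λ μ → v ≗ ⟦ μ ⟧ × Feasible μ
Qsat⇒feasible v∈Q =
  let μ , v≗⟦μ⟧ , ρ = Qsat⇒representation v∈Q in μ , v≗⟦μ⟧ , representation⇒feasible ρ

feasible⇒Qsat : {μ : Margins d} {v : Coord d → ℤ} → v ≗ ⟦ μ ⟧ → Feasible μ → Qsat d v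
feasible⇒Qsat v≗⟦μ⟧ = representation⇒Qsat v≗⟦μ⟧ ∘ feasible⇒representation

generator-feasible : IsGenerator γ → Feasible γ
generator-feasible = representation⇒feasible ∘ generator-representation

IsZero⇒mass≡0 : {μ : Margins d} {v : Coord d → ℤ} → v ≗ ⟦ μ ⟧ → IsZero d v → mass μ ≡ 0
IsZero⇒mass≡0 {d} {μ = μ} v≗⟦μ⟧ v≡0 =
  trans (sum-cong-≗ (λ m → ℤ.+-injective (trans (sym (⟦⟧-col μ m)) (trans (sym (v≗⟦μ⟧ (colC m))) (v≡0 (colC m))))))
        (sum-replicate-zero d)

mass≡0⇒IsZero : {μ : Margins d} {v : Coord d → ℤ} → v ≗ ⟦ μ ⟧ → Feasible μ → mass μ ≡ 0 → IsZero d v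
mass≡0⇒IsZero {d} v≗⟦μ⟧ μ-feasible n≡0 c =
  trans (v≗⟦μ⟧ c) (trans (⟦⟧-≋ (mass≡0⇒≋zeroₘ μ-feasible n≡0) c) (⟦⟧-zeroₘ {d} c))

-- The minimal Hilbert basis

generator⇒claimed : {γ : Margins d} {v : Coord d → ℤ} → IsGenerator γ → v ≗ ⟦ γ ⟧ → InClaimedSet d v
generator⇒claimed {d} (unit-gen i j) v≗⟦γ⟧ = inj₁ (i , j , λ c → trans (v≗⟦γ⟧ c) (sym (a≗⟦unit⟧ d i j c)))
generator⇒claimed {d} (pair-gen {k} {l} k≢l) v≗⟦γ⟧ with <-cmp k l
... | tri< k<l _ _ = inj₂ (k , l , k<l , λ c → trans (cong toℚ (v≗⟦γ⟧ c)) (sym (h≡⟦pair⟧ d k≢l c)))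
... | tri≈ _ k≡l _ = contradiction k≡l k≢l
... | tri> _ _ l<k = inj₂ (l , k , l<k , λ c →
  trans (cong toℚ (trans (v≗⟦γ⟧ c) (⟦⟧-≋ (pair-comm {k = k} {l}) c))) (sym (h≡⟦pair⟧ d (k≢l ∘ sym) c)))

claimed⇒generator : {v : Coord d → ℤ} → InClaimedSet d v → Σ (Margins d) λ γ → IsGenerator γ × v ≗ ⟦ γ ⟧
claimed⇒generator {d} (inj₁ (i , j , v≗a)) =
  unit i j , unit-gen i j , λ c → trans (v≗a c) (a≗⟦unit⟧ d i j c)
claimed⇒generator {d} (inj₂ (k , l , k<l , v≗h)) =
  pair k l , pair-gen (<ᶠ⇒≢ k<l) , λ c → toℚ-injective (trans (v≗h c) (h≡⟦pair⟧ d (<ᶠ⇒≢ k<l) c))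

min-hilbert⇒claimed : {v : Coord d → ℤ} → InMinHilbertBasis d v → InClaimedSet d v
min-hilbert⇒claimed {d} {v} (v∈Q , v≢0 , irreducible) =
  let μ , v≗⟦μ⟧ , μ-feasible = Qsat⇒feasible v∈Q
      peeling {γ} {ν} γ-generator ν-feasible split =
        peel μ-feasible (n≢0⇒n>0 (v≢0 ∘ mass≡0⇒IsZero v≗⟦μ⟧ μ-feasible))
      v≡γ+ν : ∀ c → v c ≡ addV d ⟦ γ ⟧ ⟦ ν ⟧ c
      v≡γ+ν c = trans (v≗⟦μ⟧ c) (trans (⟦⟧-≋ split c) (⟦⟧-⊕ γ ν c))
  in [ (λ ⟦γ⟧≡0 → contradiction (sym (IsZero⇒mass≡0 {μ = γ} (λ _ → refl) ⟦γ⟧≡0)) (<⇒≢ (generator-mass γ-generator)))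
     , (λ ⟦ν⟧≡0 → generator⇒claimed γ-generator
                    (λ c → trans (v≡γ+ν c) (trans (cong (λ z → ⟦ γ ⟧ c ℤ.+ z) (⟦ν⟧≡0 c)) (ℤ.+-identityʳ _))))
     ]′ (irreducible ⟦ γ ⟧ ⟦ ν ⟧ (feasible⇒Qsat (λ _ → refl) (generator-feasible γ-generator))
                                 (feasible⇒Qsat (λ _ → refl) ν-feasible) v≡γ+ν)

claimed⇒min-hilbert : {v : Coord d → ℤ} → InClaimedSet d v → InMinHilbertBasis d v
claimed⇒min-hilbert claimed =
  let γ , γ-generator , v≗⟦γ⟧ = claimed⇒generator claimed
  in feasible⇒Qsat v≗⟦γ⟧ (generator-feasible γ-generator) ,
     (λ v≡0 → <⇒≢ (generator-mass γ-generator) (sym (IsZero⇒mass≡0 {μ = γ} v≗⟦γ⟧ v≡0))) ,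
     λ u w u∈Q w∈Q v≡u+w →
       let μ , u≗⟦μ⟧ , μ-feasible = Qsat⇒feasible u∈Q
           ν , w≗⟦ν⟧ , ν-feasible = Qsat⇒feasible w∈Q
           split = ⟦⟧-split (λ c → trans (sym (v≗⟦γ⟧ c)) (trans (v≡u+w c) (cong₂ ℤ._+_ (u≗⟦μ⟧ c) (w≗⟦ν⟧ c))))
       in Sum.map (mass≡0⇒IsZero u≗⟦μ⟧ μ-feasible) (mass≡0⇒IsZero w≗⟦ν⟧ ν-feasible)
            (generator-irreducible γ-generator split μ-feasible ν-feasible)

mainTheorem2 : (d : ℕ) → 1 ≤ d → (v : Coord d → ℤ) →
    (InMinHilbertBasis d v → InClaimedSet d v) × (InClaimedSet d v → InMinHilbertBasis d v)
mainTheorem2 d _ v = min-hilbert⇒claimed , claimed⇒min-hilbert
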